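{- Let $G$ be a finite group and let $m$ be its exponent. Then: (1) the power graph of $G$ is complete iff $G$ is a cyclic $p$-group for some prime $p$; the conjugacy superpower graph of $G$ is complete iff $G$ is a cyclic $p$-group; the order superpower graph of $G$ is complete iff $G$ is a $p$-group. (2) the enhanced power graph of $G$ is complete iff $G$ is cyclic; the conjugacy superenhanced power graph of $G$ is complete iff $G$ is cyclic; the order superenhanced power graph of $G$ is complete iff $G$ has an element of order $m$. (3) the commuting graph of $G$ is complete iff $G$ is abelian; the conjugacy supercommuting graph of $G$ is complete iff $G$ is abelian; the order supercommuting graph of $G$ is complete iff $G$ has an element of order $m$.
   Context: For a finite group $G$: the power graph has vertex set $G$, with distinct $g,h$ adjacent iff one is a power of the other; the enhanced power graph: distinct $g,h$ adjacent iff $\langle g,h\rangle$ is cyclic; the commuting graph: distinct $g,h$ adjacent iff $gh=hg$. Given such a graph $\mathrm{A}$ and an equivalence relation $\mathrm{B}$ on $G$ with class $[g]$, the $\mathrm{B}$ super$\mathrm{A}$ graph has vertex set $G$, with distinct $g,h$ adjacent iff there exist $g'\in[g]$, $h'\in[h]$ that are equal or adjacent in $\mathrm{A}$. "Conjugacy super" uses $\mathrm{B}=$ conjugacy in $G$; "order super" uses $\mathrm{B}$: $g\sim h$ iff $o(g)=o(h)$. -}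

module Defs where

open import Data.Nat using (ℕ; zero; suc; _≤_; _<_; _^_)
open import Data.Nat.Primality using (Prime)
open import Data.Fin using (Fin)
open import Data.Product using (Σ; ∃; ∃-syntax; _×_; _,_)
open import Data.Sum using (_⊎_)
open import Relation.Nullary using (¬_)
open import Relation.Binary.PropositionalEquality using (_≡_)
open import Algebra.Structures using (IsGroup)

-- A finite group, presented (up to isomorphism) as a group structure on
-- Fin order with propositional equality.
record FiniteGroup : Set where
  infixl 7 _∙_
  field
    order   : ℕ
    _∙_     : Fin order → Fin order → Fin order
    ε       : Fin order
    _⁻¹     : Fin order → Fin order
    isGroup : IsGroup _≡_ _∙_ ε _⁻¹

  Carrier : Set
  Carrier = Fin order

module _ (G : FiniteGroup) where
  open FiniteGroup G

  pow : Carrier → ℕ → Carrier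
  pow g zero    = ε
  pow g (suc k) = g ∙ pow g k

  HasOrder : Carrier → ℕ → Set
  HasOrder g k = 0 < k × pow g k ≡ ε × (∀ j → 0 < j → pow g j ≡ ε → k ≤ j)

  IsExponent : ℕ → Set
  IsExponent m = 0 < m × (∀ g → pow g m ≡ ε)
                 × (∀ j → 0 < j → (∀ g → pow g j ≡ ε) → m ≤ j)

  IsCyclic : Set
  IsCyclic = ∃[ z ] (∀ h → ∃[ k ] h ≡ pow z k)

  IsAbelian : Set
  IsAbelian = ∀ a b → a ∙ b ≡ b ∙ a

  IsPGroup : Set
  IsPGroup = ∃[ p ] Prime p × ∃[ k ] order ≡ p ^ k

  IsCyclicPGroup : Set
  IsCyclicPGroup = IsCyclic × IsPGroup

  HasElementOfOrder : ℕ → Set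
  HasElementOfOrder m = ∃[ g ] HasOrder g m

  Graph : Set₁
  Graph = Carrier → Carrier → Set

  Complete : Graph → Set
  Complete Γ = ∀ g h → ¬ g ≡ h → Γ g h

  IsPowerOf : Carrier → Carrier → Set
  IsPowerOf g h = ∃[ k ] g ≡ pow h k

  PowerGraph : Graph
  PowerGraph g h = ¬ g ≡ h × (IsPowerOf g h ⊎ IsPowerOf h g)

  -- ⟨g,h⟩ is cyclic iff g and h lie in a common cyclic subgroup ⟨z⟩
  EnhancedPowerGraph : Graph
  EnhancedPowerGraph g h = ¬ g ≡ h × ∃[ z ] (IsPowerOf g z × IsPowerOf h z)

  CommutingGraph : Graph
  CommutingGraph g h = ¬ g ≡ h × g ∙ h ≡ h ∙ g

  Conjugate : Carrier → Carrier → Set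
  Conjugate g h = ∃[ x ] h ≡ (x ⁻¹) ∙ g ∙ x

  SameOrder : Carrier → Carrier → Set
  SameOrder g h = ∃[ k ] HasOrder g k × HasOrder h k

  Super : (Carrier → Carrier → Set) → Graph → Graph
  Super B A g h = ¬ g ≡ h × ∃[ g' ] ∃[ h' ] (B g g' × B h h' × (g' ≡ h' ⊎ A g' h'))

-- The power, enhanced power and commuting graphs are nested, and every super-graph contains its graph.
-- A complete conjugacy super-commuting graph says that every h commutes with a conjugate of each g, so
-- the conjugates of the centraliser of g cover G, which double counting shows forces it to be all of G.
-- Hence G is abelian, conjugacy is equality, and the conjugacy super-graphs are the graphs themselves.
-- If the enhanced power graph is complete, an element z of maximal order generates G: z and any h lie in
-- a cyclic ⟨w⟩, and ord z ∣ ord w ≤ ord z forces ⟨w⟩ = ⟨z⟩.  The subgroups of a cyclic p-group form a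
-- chain, so its power graph is complete; in any p-group the element orders form a divisibility chain,
-- so the order super-power graph is complete.  Conversely, completeness of the latter puts the element
-- orders in a divisibility chain, and Cauchy's theorem then leaves only one prime dividing |G|.
-- Finally, if y has maximal order M and commutes with x then ord x ∣ M, since otherwise a prime-power
-- part of x times a suitable power of y would have order > M.  So a complete order super-commuting graph
-- makes M the exponent, while an element z whose order is the exponent contains, for every g, an element
-- of the same order as g in ⟨z⟩, which makes the order super-enhanced power graph complete.

{-# OPTIONS --safe #-}
module Submission where

open import Defs
open import Data.Nat using (ℕ)
open import Data.Product using (_×_; _,_)
open import Function.Bundles using (_⇔_; mk⇔)
open import Function.Base using (_∘_)
open import Data.Fin using (Fin)
open import Relation.Binary.Definitions using (DecidableEquality)
open import Relation.Binary.PropositionalEquality using (_≡_)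

module NumberTheory where

  open import Data.Nat using (zero; suc; _+_; _*_; _∸_; _^_; _≤_; _<_; z≤n; s≤s; z<s; NonZero; >-nonZero; nonTrivial⇒n>1)
  open import Data.Nat.Properties
  open import Data.Nat.Divisibility
  open import Data.Nat.Coprimality as Coprimality using (Coprime; coprime-divisor)
  open import Data.Nat.Primality using (Prime; prime⇒irreducible; prime⇒nonZero; prime⇒nonTrivial; ¬prime[1])
  open import Data.Nat.Primality.Factorisation using (factorise)
  open import Data.Nat.ListAction using (product)
  open import Data.Nat.Induction using (<-rec)
  open import Data.List using ([]; _∷_; length)
  open import Data.List.Relation.Unary.All using (All; []; _∷_)
  open import Data.Product using (∃-syntax)
  open import Data.Sum using (_⊎_; inj₁; inj₂; [_,_]′)
  open import Relation.Nullary using (¬_; Dec; yes; no; contradiction)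
  open import Relation.Binary.PropositionalEquality
  open import Function.Base using (id)

  private
    variable
      p q n : ℕ

  prime⇒>1 : Prime p → 1 < p
  prime⇒>1 {p} p-prime = nonTrivial⇒n>1 p ⦃ prime⇒nonTrivial p-prime ⦄

  prime-∤⇒coprime : Prime p → ¬ p ∣ n → Coprime n p
  prime-∤⇒coprime p-prime p∤n (d∣n , d∣p) with prime⇒irreducible p-prime d∣p
  ... | inj₁ d≡1  = d≡1
  ... | inj₂ refl = contradiction d∣n p∤n

  ∣p^k⇒≡p^i : Prime p → ∀ k {d} → d ∣ p ^ k → ∃[ i ] d ≡ p ^ i
  ∣p^k⇒≡p^i p-prime zero    d∣1 = 0 , ∣1⇒≡1 d∣1
  ∣p^k⇒≡p^i {p} p-prime (suc k) {d} d∣p^1+k with p ∣? d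
  ... | no p∤d = ∣p^k⇒≡p^i p-prime k (coprime-divisor (prime-∤⇒coprime p-prime p∤d) d∣p^1+k)
  ... | yes (divides d′ refl) =
    let i , d′≡p^i = ∣p^k⇒≡p^i p-prime k {d′}
                       (*-cancelʳ-∣ p ⦃ prime⇒nonZero p-prime ⦄ (subst (d′ * p ∣_) (*-comm p (p ^ k)) d∣p^1+k))
    in suc i , trans (cong (_* p) d′≡p^i) (*-comm (p ^ i) p)

  ^-∣-≤ : ∀ p {i j} → i ≤ j → p ^ i ∣ p ^ j
  ^-∣-≤ p {i} {j} i≤j = divides (p ^ (j ∸ i)) (begin
    p ^ j               ≡⟨ cong (p ^_) (m+[n∸m]≡n i≤j) ⟨
    p ^ (i + (j ∸ i))   ≡⟨ ^-distribˡ-+-* p i (j ∸ i) ⟩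
    p ^ i * p ^ (j ∸ i) ≡⟨ *-comm (p ^ i) _ ⟩
    p ^ (j ∸ i) * p ^ i ∎)
    where open ≡-Reasoning

  ∣⇒∣^ : ∀ {d m} n → 0 < n → d ∣ m → d ∣ m ^ n
  ∣⇒∣^ {m = m} (suc n) _ d∣m = ∣m⇒∣m*n (m ^ n) d∣m

  prime-divisor : 1 < n → ∃[ p ] Prime p × p ∣ n
  prime-divisor {n} 1<n with factorise n ⦃ >-nonZero (<-trans z<s 1<n) ⦄
  ... | record { factors = [] ; isFactorisation = n≡1 } = contradiction n≡1 (>⇒≢ 1<n)
  ... | record { factors = p ∷ ps ; isFactorisation = n≡p*ps ; factorsPrime = p-prime ∷ _ } =
    p , p-prime , subst (p ∣_) (sym n≡p*ps) (m∣m*n (product ps))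

  prime-divisors-≡⇒prime-power : Prime p → .{{NonZero n}} → (∀ {q} → Prime q → q ∣ n → q ≡ p) → ∃[ e ] n ≡ p ^ e
  prime-divisors-≡⇒prime-power {p} {n} _ divisors≡p with factorise n
  ... | record { factors = ps ; isFactorisation = n≡∏ps ; factorsPrime = ps-prime } =
    length ps ,
    trans n≡∏ps (product≡ ps ps-prime (λ q-prime q∣∏ → divisors≡p q-prime (subst (_ ∣_) (sym n≡∏ps) q∣∏)))
    where
    product≡ : ∀ ps → All Prime ps → (∀ {q} → Prime q → q ∣ product ps → q ≡ p) → product ps ≡ p ^ length ps
    product≡ []       []                  _     = refl
    product≡ (q ∷ ps) (q-prime ∷ ps-prime) ∣⇒≡p =
      cong₂ _*_ (∣⇒≡p q-prime (m∣m*n (product ps)))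
                (product≡ ps ps-prime (λ r-prime r∣∏ → ∣⇒≡p r-prime (∣n⇒∣m*n q r∣∏)))

  valuation : Prime q → ∀ n → 0 < n → ∃[ f ] ∃[ m ] n ≡ q ^ f * m × ¬ q ∣ m
  valuation {q} q-prime = <-rec _ strip
    where
    strip : ∀ n → (∀ {m} → m < n → 0 < m → ∃[ f ] ∃[ m′ ] m ≡ q ^ f * m′ × ¬ q ∣ m′) →
            0 < n → ∃[ f ] ∃[ m ] n ≡ q ^ f * m × ¬ q ∣ m
    strip n rec n>0 with q ∣? n
    ... | no q∤n = 0 , n , sym (*-identityˡ n) , q∤n
    ... | yes (divides zero refl) = contradiction n>0 (<-irrefl refl)
    ... | yes (divides m@(suc _) refl) =
      let f , m′ , m≡ , q∤m′ = rec (m<m*n m q (prime⇒>1 q-prime)) z<s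
      in suc f , m′ , (begin
        m * q              ≡⟨ *-comm m q ⟩
        q * m              ≡⟨ cong (q *_) m≡ ⟩
        q * (q ^ f * m′)   ≡⟨ *-assoc q (q ^ f) m′ ⟨
        q ^ suc f * m′     ∎) , q∤m′
      where open ≡-Reasoning

  coprime-^ : Prime q → ¬ q ∣ n → ∀ e → Coprime (q ^ e) n
  coprime-^ {q} q-prime q∤n e (d∣q^e , d∣n) with ∣p^k⇒≡p^i q-prime e d∣q^e
  ... | zero  , d≡1  = d≡1
  ... | suc i , refl = contradiction (∣-trans (m∣m*n (q ^ i)) d∣n) q∤n

  coprime-∣-* : ∀ {a b n} → Coprime a b → a ∣ n → b ∣ n → a * b ∣ n
  coprime-∣-* {a} {b} a⊥b (divides t refl) b∣t*a
    with coprime-divisor (Coprimality.sym a⊥b) (subst (b ∣_) (*-comm t a) b∣t*a)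
  ... | divides s refl = divides s (trans (*-assoc s b a) (cong (s *_) (*-comm b a)))

  prime-∣-prime⇒≡ : Prime p → Prime q → p ∣ q → p ≡ q
  prime-∣-prime⇒≡ p-prime q-prime p∣q with prime⇒irreducible q-prime p∣q
  ... | inj₁ refl = contradiction p-prime ¬prime[1]
  ... | inj₂ p≡q  = p≡q

  -- Split off a prime q ∣ a: either q ∤ M, or M = M₁ * q and the claim for a / q and M₁ lifts.
  ∤⇒prime-power-∤ : ∀ a {M} → 0 < a → ¬ a ∣ M → ∃[ q ] Prime q × ∃[ e ] q ^ e ∣ a × ¬ q ^ e ∣ M
  ∤⇒prime-power-∤ = <-rec _ peel
    where
    Witness : ℕ → ℕ → Set
    Witness a M = ∃[ q ] Prime q × ∃[ e ] q ^ e ∣ a × ¬ q ^ e ∣ M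

    peel : ∀ a → (∀ {b} → b < a → ∀ {M} → 0 < b → ¬ b ∣ M → Witness b M) →
           ∀ {M} → 0 < a → ¬ a ∣ M → Witness a M
    peel (suc zero) _ {M} _ 1∤M = contradiction (1∣ M) 1∤M
    peel a@(suc (suc _)) rec {M} _ a∤M with prime-divisor {a} (s≤s (s≤s z≤n))
    ... | q , q-prime , divides zero ()
    ... | q , q-prime , divides a₁@(suc _) a≡a₁*q with q ∣? M
    ...   | no q∤M = q , q-prime , 1 , subst (_∣ a) (sym (*-identityʳ q)) (divides a₁ a≡a₁*q) ,
                     λ q^1∣M → q∤M (subst (_∣ M) (*-identityʳ q) q^1∣M)
    ...   | yes (divides M₁ refl) with rec (subst (a₁ <_) (sym a≡a₁*q) (m<m*n a₁ q (prime⇒>1 q-prime))) z<s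
                                           (λ a₁∣M₁ → a∤M (subst (_∣ M₁ * q) (sym a≡a₁*q) (*-monoˡ-∣ q a₁∣M₁)))
    ...     | r , r-prime , e , r^e∣a₁ , r^e∤M₁ with r ≟ q
    ...       | yes refl = q , q-prime , suc e ,
                  subst (q * q ^ e ∣_) (trans (*-comm q a₁) (sym a≡a₁*q)) (*-monoʳ-∣ q r^e∣a₁) ,
                  λ q^1+e∣M → r^e∤M₁ (*-cancelʳ-∣ q ⦃ prime⇒nonZero q-prime ⦄
                                        (subst (_∣ M₁ * q) (*-comm q (q ^ e)) q^1+e∣M))
    ...       | no r≢q = r , r-prime , e , ∣-trans r^e∣a₁ (divides q (trans a≡a₁*q (*-comm a₁ q))) ,
                  λ r^e∣M → r^e∤M₁ (coprime-divisor (coprime-^ r-prime (r≢q ∘ prime-∣-prime⇒≡ r-prime q-prime) e)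
                                                     (subst (r ^ e ∣_) (*-comm M₁ q) r^e∣M))

  least-witness : {P : ℕ → Set} → (∀ n → Dec (P n)) → ∀ {k} → P k → ∃[ m ] P m × (∀ j → j < m → ¬ P j)
  least-witness {P} P? {k} pk = [ (λ none → contradiction pk (none k ≤-refl)) , id ]′ (search (suc k))
    where
    search : ∀ n → (∀ j → j < n → ¬ P j) ⊎ ∃[ m ] P m × (∀ j → j < m → ¬ P j)
    search zero = inj₁ (λ _ ())
    search (suc n) with search n | P? n
    ... | inj₂ found | _     = inj₂ found
    ... | inj₁ none  | yes p = inj₂ (n , p , none)
    ... | inj₁ none  | no ¬p = inj₁ λ j j<1+n → [ none j , (λ { refl → ¬p }) ]′ (m<1+n⇒m<n∨m≡n j<1+n)

module Counting where

  open import Data.Nat using (zero; suc; _+_; _*_; _≤_; _<_; z≤n; s≤s)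
  open import Data.Nat.Properties
    using (+-0-commutativeMonoid; ≤-refl; ≤-trans; ≤-reflexive; <-irrefl; +-mono-≤; +-monoˡ-≤; +-cancelˡ-≤;
           +-assoc; +-comm; ≤-antisym; *-identityʳ; m≤n+m; module ≤-Reasoning)
  open import Data.Fin using (Fin; zero; suc; _≟_)
  open import Data.Fin.Properties using (suc-injective; 0≢1+n; any?)
  open import Data.Product using (∃; proj₁)
  open import Data.Unit using (tt)
  open import Relation.Nullary using (¬_; Dec; yes; no; contradiction)
  open import Relation.Nullary.Decidable using (_×-dec_; ¬?)
  open import Relation.Unary using (Decidable)
  open import Relation.Unary.Properties using (U?)
  open import Relation.Binary.PropositionalEquality
  open import Algebra.Properties.CommutativeMonoid.Sum +-0-commutativeMonoid
    using (sum; sum-cong-≗; ∑-distrib-+)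

  private
    variable
      N M : ℕ

  sum-const : ∀ N c → sum {N} (λ _ → c) ≡ N * c
  sum-const zero    c = refl
  sum-const (suc N) c = cong (c +_) (sum-const N c)

  sum-1 : ∀ N → sum {N} (λ _ → 1) ≡ N
  sum-1 N = trans (sum-const N 1) (*-identityʳ N)

  sum-mono-≤ : {f g : Fin N → ℕ} → (∀ i → f i ≤ g i) → sum f ≤ sum g
  sum-mono-≤ {zero}  f≤g = z≤n
  sum-mono-≤ {suc N} f≤g = +-mono-≤ (f≤g zero) (sum-mono-≤ (f≤g ∘ suc))

  N*c+d≤sum : ∀ {f : Fin N → ℕ} {c d} (a : Fin N) →
              (∀ i → c ≤ f i) → c + d ≤ f a → N * c + d ≤ sum f
  N*c+d≤sum {suc N} {f} {c} {d} zero c≤f c+d≤fa = begin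
    c + N * c + d   ≡⟨ +-assoc c (N * c) d ⟩
    c + (N * c + d) ≡⟨ cong (c +_) (+-comm (N * c) d) ⟩
    c + (d + N * c) ≡⟨ +-assoc c d (N * c) ⟨
    c + d + N * c   ≡⟨ cong (c + d +_) (sum-const N c) ⟨
    c + d + sum {N} (λ _ → c)
                    ≤⟨ +-mono-≤ c+d≤fa (sum-mono-≤ (λ i → c≤f (suc i))) ⟩
    sum f           ∎
    where open ≤-Reasoning
  N*c+d≤sum {suc N} {f} {c} {d} (suc a) c≤f c+d≤fa = begin
    c + N * c + d   ≡⟨ +-assoc c (N * c) d ⟩
    c + (N * c + d) ≤⟨ +-mono-≤ (c≤f zero) (N*c+d≤sum a (λ i → c≤f (suc i)) c+d≤fa) ⟩
    sum f           ∎
    where open ≤-Reasoning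

  indicator : {A : Set} → Dec A → ℕ
  indicator (yes _) = 1
  indicator (no _)  = 0

  count : {P : Fin N → Set} → Decidable P → ℕ
  count P? = sum (λ x → indicator (P? x))

  indicator-cong : {A B : Set} (a? : Dec A) (b? : Dec B) → (A → B) → (B → A) → indicator a? ≡ indicator b?
  indicator-cong (yes _) (yes _) _   _   = refl
  indicator-cong (yes a) (no ¬b) a→b _   = contradiction (a→b a) ¬b
  indicator-cong (no ¬a) (yes b) _   b→a = contradiction (b→a b) ¬a
  indicator-cong (no _)  (no _)  _   _   = refl

  count-cong : {P Q : Fin N → Set} (P? : Decidable P) (Q? : Decidable Q) →
               (∀ x → P x → Q x) → (∀ x → Q x → P x) → count P? ≡ count Q?
  count-cong P? Q? P⇒Q Q⇒P = sum-cong-≗ (λ x → indicator-cong (P? x) (Q? x) (P⇒Q x) (Q⇒P x))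

  count-split : {P Q : Fin N → Set} (P? : Decidable P) (Q? : Decidable Q) →
                count P? ≡ count (λ x → P? x ×-dec Q? x) + count (λ x → P? x ×-dec ¬? (Q? x))
  count-split P? Q? = trans (sum-cong-≗ (λ x → split (P? x) (Q? x)))
                            (∑-distrib-+ (λ x → indicator (P? x ×-dec Q? x)) (λ x → indicator (P? x ×-dec ¬? (Q? x))))
    where
    split : {A B : Set} (a? : Dec A) (b? : Dec B) → indicator a? ≡ indicator (a? ×-dec b?) + indicator (a? ×-dec ¬? b?)
    split (yes _) (yes _) = refl
    split (yes _) (no _)  = refl
    split (no _)  (yes _) = refl
    split (no _)  (no _)  = refl

  count-≤ : {P : Fin N → Set} (P? : Decidable P) → count P? ≤ N
  count-≤ {N} P? = ≤-trans (sum-mono-≤ (λ x → indicator≤1 (P? x))) (≤-reflexive (sum-1 N))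
    where
    indicator≤1 : {A : Set} (a? : Dec A) → indicator a? ≤ 1
    indicator≤1 (yes _) = s≤s z≤n
    indicator≤1 (no _)  = z≤n

  count-all : {P : Fin N → Set} (P? : Decidable P) → (∀ x → P x) → count P? ≡ N
  count-all {N} P? all = trans (sum-cong-≗ (λ x → indicator-yes (P? x) (all x))) (sum-1 N)
    where
    indicator-yes : {A : Set} (a? : Dec A) → A → indicator a? ≡ 1
    indicator-yes (yes _) _ = refl
    indicator-yes (no ¬a) a = contradiction a ¬a

  N≤count⇒all : {P : Fin N → Set} (P? : Decidable P) → N ≤ count P? → ∀ x → P x
  N≤count⇒all {suc N} P? N≤count x with P? zero
  N≤count⇒all {suc N} P? _         zero    | yes p = p
  N≤count⇒all {suc N} P? (s≤s N≤c) (suc x) | yes _ = N≤count⇒all (P? ∘ suc) N≤c x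
  N≤count⇒all {suc N} P? N≤count  x        | no _  = contradiction (≤-trans N≤count (count-≤ (P? ∘ suc))) (<-irrefl refl)

  count>0⇒∃ : {P : Fin N → Set} (P? : Decidable P) → 0 < count P? → ∃ P
  count>0⇒∃ {suc N} P? count>0 with P? zero
  ... | yes p = zero , p
  ... | no _  = let x , px = count>0⇒∃ (P? ∘ suc) count>0 in suc x , px

  ∈⇒count>0 : {P : Fin N → Set} (P? : Decidable P) {a : Fin N} → P a → 0 < count P?
  ∈⇒count>0 P? {zero} pa with P? zero
  ... | yes _  = s≤s z≤n
  ... | no ¬pa = contradiction pa ¬pa
  ∈⇒count>0 P? {suc a} pa = ≤-trans (∈⇒count>0 (P? ∘ suc) pa) (m≤n+m _ (indicator (P? zero)))

  count-≤-injection : {P : Fin N → Set} {Q : Fin M → Set} (P? : Decidable P) (Q? : Decidable Q) (f : ∀ x → P x → Fin M) →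
                      (∀ x p → Q (f x p)) → (∀ x y p q → f x p ≡ f y q → x ≡ y) → count P? ≤ count Q?
  count-≤-injection {zero}  P? Q? f f∈Q f-inj = z≤n
  count-≤-injection {suc N} P? Q? f f∈Q f-inj with P? zero
  ... | no _ = count-≤-injection (P? ∘ suc) Q? (f ∘ suc) (f∈Q ∘ suc)
                 (λ x y p q e → suc-injective (f-inj (suc x) (suc y) p q e))
  ... | yes p₀ = begin
    suc (count (P? ∘ suc))                               ≤⟨ s≤s (count-≤-injection (P? ∘ suc) Q≢a? (f ∘ suc)
                                                              (λ x p → f∈Q (suc x) p , λ e → 0≢1+n (f-inj _ _ p₀ p (sym e)))
                                                              (λ x y p q e → suc-injective (f-inj (suc x) (suc y) p q e))) ⟩
    suc (count Q≢a?)                                     ≤⟨ +-monoˡ-≤ (count Q≢a?) (∈⇒count>0 Q≡a? (f∈Q zero p₀ , refl)) ⟩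
    count Q≡a? + count Q≢a?                              ≡⟨ count-split Q? (_≟ a) ⟨
    count Q?                                             ∎
    where
    open ≤-Reasoning
    a = f zero p₀
    Q≡a? Q≢a? : Decidable _
    Q≡a? y = Q? y ×-dec (y ≟ a)
    Q≢a? y = Q? y ×-dec ¬? (y ≟ a)

  count-U : count (U? {A = Fin N}) ≡ N
  count-U = count-all U? (λ _ → tt)

  count-image : (f : Fin M → Fin N) → (∀ {i j} → f i ≡ f j → i ≡ j) → count (λ y → any? (λ i → y ≟ f i)) ≡ M
  count-image f f-injective = ≤-antisym
    (≤-trans (count-≤-injection image? U? (λ _ → proj₁) (λ _ _ → tt)
               (λ _ _ (_ , e) (_ , e′) i≡j → trans e (trans (cong f i≡j) (sym e′))))
             (≤-reflexive count-U))
    (≤-trans (≤-reflexive (sym count-U))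
             (count-≤-injection U? image? (λ i _ → f i) (λ i _ → i , refl) (λ _ _ _ _ → f-injective)))
    where
    image? = λ y → any? (λ i → y ≟ f i)

  count≥2⇒∃≢ : {P : Fin N → Set} (P? : Decidable P) → 2 ≤ count P? → ∀ a → ∃ λ x → P x × ¬ x ≡ a
  count≥2⇒∃≢ P? 2≤count a = count>0⇒∃ P≢a? count-P≢a>0
    where
    P≡a? P≢a? : Decidable _
    P≡a? x = P? x ×-dec (x ≟ a)
    P≢a? x = P? x ×-dec ¬? (x ≟ a)
    count-P≡a≤1 : count P≡a? ≤ 1
    count-P≡a≤1 = ≤-trans (count-≤-injection P≡a? (U? {A = Fin 1}) (λ _ _ → zero) (λ _ _ → tt)
                            (λ _ _ (_ , x≡a) (_ , y≡a) _ → trans x≡a (sym y≡a)))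
                          (≤-reflexive count-U)
    count-P≢a>0 : 0 < count P≢a?
    count-P≢a>0 = +-cancelˡ-≤ 1 1 (count P≢a?) (begin
      2                          ≤⟨ 2≤count ⟩
      count P?                   ≡⟨ count-split P? (_≟ a) ⟩
      count P≡a? + count P≢a?    ≤⟨ +-monoˡ-≤ (count P≢a?) count-P≡a≤1 ⟩
      1 + count P≢a?             ∎)
      where open ≤-Reasoning

module Iteration {A : Set} (_≟_ : DecidableEquality A) (σ : A → A)
                 (σ-injective : ∀ {x y} → σ x ≡ σ y → x ≡ y) where
  open import Data.Nat using (zero; suc; _+_; _*_; _∸_; _≤_; _<_; z<s; NonZero)
  open import Data.Nat.Properties hiding (_≟_)
  open import Data.Nat.DivMod using (_%_; _/_; m≡m%n+[m/n]*n; m%n<n)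
  open import Data.Nat.Divisibility using (_∣_; m%n≡0⇒n∣m)
  open import Data.Nat.GeneralisedArithmetic using (fold; fold-+)
  open import Data.Product using (∃)
  open import Data.Sum using (inj₁; inj₂)
  open import Relation.Nullary using (contradiction)
  open import Relation.Nullary.Decidable using (_×-dec_)
  open import Relation.Binary.PropositionalEquality
  open NumberTheory using (least-witness)

  iter : ℕ → A → A
  iter k x = fold x σ k

  iter-+ : ∀ m n x → iter (m + n) x ≡ iter m (iter n x)
  iter-+ m n x = fold-+ x σ m

  iter-injective : ∀ k {x y} → iter k x ≡ iter k y → x ≡ y
  iter-injective zero    e = e
  iter-injective (suc k) e = iter-injective k (σ-injective e)

  IsPeriod : A → ℕ → Set
  IsPeriod x d = 0 < d × iter d x ≡ x × (∀ j → 0 < j → iter j x ≡ x → d ≤ j)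

  iter-multiple : ∀ {x} d t → iter d x ≡ x → iter (t * d) x ≡ x
  iter-multiple d zero    _   = refl
  iter-multiple {x} d (suc t) fix = begin
    iter (d + t * d) x      ≡⟨ iter-+ d (t * d) x ⟩
    iter d (iter (t * d) x) ≡⟨ cong (iter d) (iter-multiple d t fix) ⟩
    iter d x                ≡⟨ fix ⟩
    x                       ∎
    where open ≡-Reasoning

  iter-% : ∀ {x} d .{{_ : NonZero d}} → iter d x ≡ x → ∀ a → iter a x ≡ iter (a % d) x
  iter-% {x} d fix a = begin
    iter a x                                 ≡⟨ cong (λ n → iter n x) (m≡m%n+[m/n]*n a d) ⟩
    iter (a % d + a / d * d) x               ≡⟨ iter-+ (a % d) (a / d * d) x ⟩
    iter (a % d) (iter (a / d * d) x)        ≡⟨ cong (iter (a % d)) (iter-multiple d (a / d) fix) ⟩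
    iter (a % d) x                           ∎
    where open ≡-Reasoning

  iter-∸ : ∀ {x} a b → a ≤ b → iter a x ≡ iter b x → iter (b ∸ a) x ≡ x
  iter-∸ {x} a b a≤b e = iter-injective a (begin
    iter a (iter (b ∸ a) x) ≡⟨ iter-+ a (b ∸ a) x ⟨
    iter (a + (b ∸ a)) x    ≡⟨ cong (λ n → iter n x) (m+[n∸m]≡n a≤b) ⟩
    iter b x                ≡⟨ e ⟨
    iter a x                ∎)
    where open ≡-Reasoning

  period-exists : ∀ {x} k → 0 < k → iter k x ≡ x → ∃ (IsPeriod x)
  period-exists {x} k k>0 fix with least-witness (λ j → (0 <? j) ×-dec (iter j x ≟ x)) (k>0 , fix)
  ... | d , (d>0 , fix-d) , below = d , d>0 , fix-d , λ j j>0 fix-j → ≮⇒≥ (λ j<d → below j j<d (j>0 , fix-j))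

  period-minimal : ∀ {x d} n → IsPeriod x d → iter n x ≡ x → n < d → n ≡ 0
  period-minimal zero    _             _   _   = refl
  period-minimal (suc n) (_ , _ , min) fix n<d = contradiction (min (suc n) z<s fix) (<⇒≱ n<d)

  period-∣ : ∀ {x d} a → IsPeriod x d → iter a x ≡ x → d ∣ a
  period-∣ {d = d@(suc _)} a per@(_ , fix , _) fix-a =
    m%n≡0⇒n∣m a d (period-minimal (a % d) per (trans (sym (iter-% d fix a)) fix-a) (m%n<n a d))

  period-distinct-≤ : ∀ {x d} i j → IsPeriod x d → i ≤ j → j < d → iter i x ≡ iter j x → i ≡ j
  period-distinct-≤ i j per i≤j j<d e =
    ≤-antisym i≤j (m∸n≡0⇒m≤n (period-minimal (j ∸ i) per (iter-∸ i j i≤j e) (≤-<-trans (m∸n≤m j i) j<d)))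

  period-distinct : ∀ {x d} i j → IsPeriod x d → i < d → j < d → iter i x ≡ iter j x → i ≡ j
  period-distinct i j per i<d j<d e with ≤-total i j
  ... | inj₁ i≤j = period-distinct-≤ i j per i≤j j<d e
  ... | inj₂ j≤i = sym (period-distinct-≤ j i per j≤i i<d (sym e))

module Orbits {N : ℕ} (σ : Fin N → Fin N) (σ-injective : ∀ {x y} → σ x ≡ σ y → x ≡ y) where
  open import Data.Nat using (zero; suc; pred; _+_; _≤_; _<_; z<s; s≤s; >-nonZero)
  open import Data.Nat.Properties hiding (_≟_)
  open import Data.Nat.DivMod using (m%n<n)
  open import Data.Nat.Divisibility using (_∣_; _∣0; ∣-refl; ∣m∣n⇒∣m+n)
  open import Data.Fin using (toℕ; fromℕ<; _≟_)
  open import Data.Fin.Properties using (any?; toℕ-injective; toℕ<n; toℕ-fromℕ<)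
  open import Data.Product using (∃; proj₁; proj₂)
  open import Relation.Nullary using (¬_)
  open import Relation.Nullary.Decidable using (_×-dec_; ¬?)
  open import Relation.Unary using (Decidable)
  open import Relation.Binary.PropositionalEquality
  open Counting
  open Iteration _≟_ σ σ-injective

  module Orbit {k x₀} (period : IsPeriod x₀ k) where

    private instance
      k-nonZero = >-nonZero (proj₁ period)

    InOrbit : Fin N → Set
    InOrbit y = ∃ λ (i : Fin k) → y ≡ iter (toℕ i) x₀

    InOrbit? : Decidable InOrbit
    InOrbit? y = any? (λ i → y ≟ iter (toℕ i) x₀)

    iter∈Orbit : ∀ j → InOrbit (iter j x₀)
    iter∈Orbit j = fromℕ< (m%n<n j k) ,
      trans (iter-% k (proj₁ (proj₂ period)) j) (cong (λ n → iter n x₀) (sym (toℕ-fromℕ< (m%n<n j k))))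

    σ-preimage∈Orbit : ∀ {y} → InOrbit (σ y) → InOrbit y
    σ-preimage∈Orbit {y} (i , σy≡) = subst InOrbit (sym (σ-injective (begin
      σ y                                 ≡⟨ σy≡ ⟩
      iter (toℕ i) x₀                     ≡⟨ cong (iter (toℕ i)) (proj₁ (proj₂ period)) ⟨
      iter (toℕ i) (iter k x₀)            ≡⟨ iter-+ (toℕ i) k x₀ ⟨
      iter (toℕ i + k) x₀                 ≡⟨ cong (λ n → iter (toℕ i + n) x₀) (suc-pred k) ⟨
      iter (toℕ i + suc (pred k)) x₀      ≡⟨ cong (λ n → iter n x₀) (+-suc (toℕ i) (pred k)) ⟩
      σ (iter (toℕ i + pred k) x₀)        ∎))) (iter∈Orbit (toℕ i + pred k))
      where open ≡-Reasoning

    count-Orbit : count InOrbit? ≡ k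
    count-Orbit = count-image (λ i → iter (toℕ i) x₀)
      (λ {i} {j} e → toℕ-injective (period-distinct (toℕ i) (toℕ j) period (toℕ<n i) (toℕ<n j) e))

  -- Remove the orbit of some x₀ ∈ S, which has exactly k points, and recurse.
  period-∣-count : ∀ k {S : Fin N → Set} (S? : Decidable S) →
                   (∀ x → S x → S (σ x)) → (∀ x → S x → IsPeriod x k) → k ∣ count S?
  period-∣-count k S? closed periodic = remove-orbits (count S?) S? closed periodic ≤-refl
    where
    remove-orbits : ∀ n {S : Fin N → Set} (S? : Decidable S) → (∀ x → S x → S (σ x)) →
                    (∀ x → S x → IsPeriod x k) → count S? ≤ n → k ∣ count S?
    remove-orbits n S? closed periodic bound with count S? in count≡
    ... | zero = k ∣0
    remove-orbits (suc n) {S} S? closed periodic (s≤s bound) | suc _ with count>0⇒∃ S? (subst (0 <_) (sym count≡) z<s)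
    ... | x₀ , x₀∈S = subst (k ∣_) (trans (sym count-S) count≡)
                        (∣m∣n⇒∣m+n ∣-refl (remove-orbits n S∖O? closed′ (λ y → periodic y ∘ proj₁) bound′))
      where
      open Orbit (periodic x₀ x₀∈S)

      S∖O? : Decidable (λ y → S y × ¬ InOrbit y)
      S∖O? y = S? y ×-dec ¬? (InOrbit? y)

      closed′ : ∀ y → S y × ¬ InOrbit y → S (σ y) × ¬ InOrbit (σ y)
      closed′ y (y∈S , y∉O) = closed y y∈S , y∉O ∘ σ-preimage∈Orbit

      iter∈S : ∀ j → S (iter j x₀)
      iter∈S zero    = x₀∈S
      iter∈S (suc j) = closed _ (iter∈S j)

      count-S : count S? ≡ k + count S∖O?
      count-S = trans (count-split S? InOrbit?)
        (cong (_+ count S∖O?) (trans (count-cong _ InOrbit? (λ _ → proj₂) (λ _ (i , e) → subst S (sym e) (iter∈S (toℕ i)) , (i , e)))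
                                     count-Orbit))

      bound′ : count S∖O? ≤ n
      bound′ = ≤-pred (≤-trans (m<n+m (count S∖O?) (proj₁ (periodic x₀ x₀∈S)))
                               (≤-trans (≤-reflexive (trans (sym count-S) count≡)) (s≤s bound)))

module Tuples where

  open import Data.Nat using (zero; suc; _^_)
  open import Data.Nat.GeneralisedArithmetic using (fold; iterate; iterate-is-fold)
  open import Data.Fin using (zero; combine; remQuot)
  open import Data.Fin.Properties using (remQuot-combine; combine-remQuot)
  open import Data.List using (List; []; _∷_; _++_; [_]; length)
  open import Data.List.Properties using (++-assoc; ++-identityʳ)
  open import Data.Vec using (Vec; []; _∷_; _∷ʳ_; replicate; head; toList)
  open import Data.Vec.Properties using (∷ʳ-injective; ∷-injective; toList-∷ʳ; toList-injective; length-toList)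
  open import Data.Vec.Relation.Binary.Equality.Cast using (cast-is-id)
  open import Data.Product using (proj₁; proj₂)
  open import Relation.Binary.PropositionalEquality hiding ([_])
  open import Function.Base using (flip)

  private
    variable
      A : Set
      n k : ℕ

  -- Tuples are encoded in Fin (n ^ k) so that sets of tuples can be counted.
  encode : Vec (Fin n) k → Fin (n ^ k)
  encode []       = zero
  encode (x ∷ xs) = combine x (encode xs)

  decode : ∀ k → Fin (n ^ k) → Vec (Fin n) k
  decode zero    _ = []
  decode {n} (suc k) c = proj₁ (remQuot {n} (n ^ k) c) ∷ decode k (proj₂ (remQuot {n} (n ^ k) c))

  decode-encode : (v : Vec (Fin n) k) → decode k (encode v) ≡ v
  decode-encode []                   = refl
  decode-encode {n} {suc k} (x ∷ xs) =
    cong₂ _∷_ (cong proj₁ (remQuot-combine x (encode xs)))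
              (trans (cong (decode k ∘ proj₂) (remQuot-combine {n} x (encode xs))) (decode-encode xs))

  encode-decode : ∀ k (c : Fin (n ^ k)) → encode (decode k c) ≡ c
  encode-decode zero    zero = refl
  encode-decode {n} (suc k) c =
    trans (cong (combine (proj₁ (remQuot {n} (n ^ k) c))) (encode-decode k (proj₂ (remQuot {n} (n ^ k) c))))
          (combine-remQuot {n} (n ^ k) c)

  encode-injective : {v w : Vec (Fin n) k} → encode v ≡ encode w → v ≡ w
  encode-injective {v = v} {w} e = trans (sym (decode-encode v)) (trans (cong (decode _) e) (decode-encode w))

  decode-injective : ∀ k {c c′ : Fin (n ^ k)} → decode k c ≡ decode k c′ → c ≡ c′
  decode-injective k {c} {c′} e = trans (sym (encode-decode k c)) (trans (cong encode e) (encode-decode k c′))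

  rotate : Vec A (suc k) → Vec A (suc k)
  rotate (x ∷ xs) = xs ∷ʳ x

  rotate-injective : {v w : Vec A (suc k)} → rotate v ≡ rotate w → v ≡ w
  rotate-injective {v = x ∷ xs} {y ∷ ys} e with ∷ʳ-injective xs ys e
  ... | refl , refl = refl

  rotate-fixed⇒replicate : (v : Vec A (suc k)) → rotate v ≡ v → v ≡ replicate (suc k) (head v)
  rotate-fixed⇒replicate (x ∷ xs) fixed = cong (x ∷_) (constant xs fixed)
    where
    constant : ∀ {k} (xs : Vec _ k) → xs ∷ʳ x ≡ x ∷ xs → xs ≡ replicate k x
    constant []       _ = refl
    constant (y ∷ ys) e with ∷-injective e
    ... | refl , e′ = cong (y ∷_) (constant ys e′)

  rotate-replicate : ∀ k (x : A) → rotate (replicate (suc k) x) ≡ replicate (suc k) x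
  rotate-replicate k x = ∷ʳ-replicate k
    where
    ∷ʳ-replicate : ∀ k → replicate k x ∷ʳ x ≡ x ∷ replicate k x
    ∷ʳ-replicate zero    = refl
    ∷ʳ-replicate (suc k) = cong (x ∷_) (∷ʳ-replicate k)

  rotateList : List A → List A
  rotateList []       = []
  rotateList (x ∷ xs) = xs ++ [ x ]

  rotateList-++ : (xs ys : List A) → iterate rotateList (xs ++ ys) (length xs) ≡ ys ++ xs
  rotateList-++ []       ys = sym (++-identityʳ ys)
  rotateList-++ (x ∷ xs) ys = begin
    iterate rotateList ((xs ++ ys) ++ [ x ]) (length xs)  ≡⟨ cong (flip (iterate rotateList) (length xs)) (++-assoc xs ys [ x ]) ⟩
    iterate rotateList (xs ++ (ys ++ [ x ])) (length xs)  ≡⟨ rotateList-++ xs (ys ++ [ x ]) ⟩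
    (ys ++ [ x ]) ++ xs                                   ≡⟨ ++-assoc ys [ x ] xs ⟩
    ys ++ x ∷ xs                                          ∎
    where open ≡-Reasoning

  toList-rotate^ : ∀ j (v : Vec A (suc k)) → toList (fold v rotate j) ≡ fold (toList v) rotateList j
  toList-rotate^ zero    v = refl
  toList-rotate^ (suc j) v with fold v rotate j | toList-rotate^ j v
  ... | x ∷ xs | e = trans (toList-∷ʳ x xs) (cong rotateList e)

  rotate^length≡id : (v : Vec A (suc k)) → fold v rotate (suc k) ≡ v
  rotate^length≡id {k = k} v = trans (sym (cast-is-id refl _)) (toList-injective refl _ v (begin
    toList (fold v rotate (suc k))                              ≡⟨ toList-rotate^ (suc k) v ⟩
    fold (toList v) rotateList (suc k)                          ≡⟨ iterate-is-fold (toList v) rotateList (suc k) ⟩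
    iterate rotateList (toList v) (suc k)                       ≡⟨ cong (iterate rotateList (toList v)) (length-toList v) ⟨
    iterate rotateList (toList v) (length (toList v))           ≡⟨ cong (flip (iterate rotateList) (length (toList v))) (++-identityʳ (toList v)) ⟨
    iterate rotateList (toList v ++ []) (length (toList v))     ≡⟨ rotateList-++ (toList v) [] ⟩
    toList v                                                    ∎))
    where open ≡-Reasoning

module GroupTheory (G : FiniteGroup) where
  open import Level using (0ℓ)
  open import Algebra.Bundles using (Group)
  open import Algebra.Structures using (IsGroup)
  open import Data.Nat using (zero; suc; _+_; _*_; _∸_; _≤_; _<_; z≤n; s≤s; z<s; >-nonZero)
  open import Data.Nat.Properties hiding (_≟_)
  open import Algebra.Properties.CommutativeSemigroup *-commutativeSemigroup using (x∙yz≈y∙xz)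
  open import Data.Nat.Divisibility using (_∣_; divides; ∣-refl; ∣⇒≤; *-cancelʳ-∣; m∣m*n; n∣m*n)
  open import Data.Nat.Coprimality as Coprimality using (Coprime; coprime-divisor; coprime⇒gcd≡1)
  open import Data.Nat.GCD using (gcd; gcd-GCD; module Bézout)
  open import Data.Nat.Primality using (Prime; prime⇒irreducible)
  open import Data.Fin using (toℕ; _≟_)
  open import Data.Fin.Properties using (pigeonhole)
  open import Data.List using (allFin)
  open import Data.List.Extrema.Nat using (argmax; f[xs]≤f[argmax])
  open import Data.List.Membership.Propositional.Properties using (∈-allFin)
  import Data.List.Relation.Unary.All as All
  open import Data.Product using (∃; ∃-syntax; proj₁; proj₂)
  open import Data.Sum using (inj₁; inj₂)
  open import Data.Unit using (tt)
  open import Relation.Nullary using (¬_; contradiction)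
  open import Relation.Unary.Properties using (U?)
  open import Relation.Binary.PropositionalEquality
  open NumberTheory using (coprime-∣-*)
  open Counting
  open FiniteGroup G
  open IsGroup isGroup using (assoc; identityˡ; identityʳ)
  open ≡-Reasoning

  group : Group 0ℓ 0ℓ
  group = record { Carrier = Carrier ; _≈_ = _≡_ ; _∙_ = _∙_ ; ε = ε ; _⁻¹ = _⁻¹ ; isGroup = isGroup }

  open import Algebra.Properties.Group group public
    using (∙-cancelˡ; ∙-cancelʳ; inverseˡ-unique; inverseʳ-unique; ε⁻¹≈ε; ⁻¹-anti-homo-∙)

  infixr 8 _^_
  _^_ : Carrier → ℕ → Carrier
  _^_ = pow G

  ^-+ : ∀ g m n → g ^ (m + n) ≡ g ^ m ∙ g ^ n
  ^-+ g zero    n = sym (identityˡ _)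
  ^-+ g (suc m) n = trans (cong (g ∙_) (^-+ g m n)) (sym (assoc _ _ _))

  ^-^ : ∀ g m n → (g ^ m) ^ n ≡ g ^ (n * m)
  ^-^ g m zero    = refl
  ^-^ g m (suc n) = trans (cong (g ^ m ∙_) (^-^ g m n)) (sym (^-+ g m (n * m)))

  ε-^ : ∀ n → ε ^ n ≡ ε
  ε-^ zero    = refl
  ε-^ (suc n) = trans (identityˡ _) (ε-^ n)

  ^-1 : ∀ g → g ^ 1 ≡ g
  ^-1 = identityʳ

  Commute : Carrier → Carrier → Set
  Commute x y = x ∙ y ≡ y ∙ x

  commute-^ʳ : ∀ {x y} n → Commute x y → Commute x (y ^ n)
  commute-^ʳ {x} {y} zero    _ = trans (identityʳ x) (sym (identityˡ x))
  commute-^ʳ {x} {y} (suc n) xy≡yx = begin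
    x ∙ (y ∙ y ^ n)   ≡⟨ assoc x y _ ⟨
    (x ∙ y) ∙ y ^ n   ≡⟨ cong (_∙ y ^ n) xy≡yx ⟩
    (y ∙ x) ∙ y ^ n   ≡⟨ assoc y x _ ⟩
    y ∙ (x ∙ y ^ n)   ≡⟨ cong (y ∙_) (commute-^ʳ n xy≡yx) ⟩
    y ∙ (y ^ n ∙ x)   ≡⟨ assoc y _ x ⟨
    (y ∙ y ^ n) ∙ x   ∎

  commute-^ : ∀ {x y} m n → Commute x y → Commute (x ^ m) (y ^ n)
  commute-^ m n xy≡yx = sym (commute-^ʳ m (sym (commute-^ʳ n xy≡yx)))

  ∙-^ : ∀ {x y} n → Commute x y → (x ∙ y) ^ n ≡ x ^ n ∙ y ^ n
  ∙-^ zero    _ = sym (identityˡ ε)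
  ∙-^ {x} {y} (suc n) xy≡yx = begin
    (x ∙ y) ∙ (x ∙ y) ^ n       ≡⟨ cong ((x ∙ y) ∙_) (∙-^ n xy≡yx) ⟩
    (x ∙ y) ∙ (x ^ n ∙ y ^ n)   ≡⟨ assoc x y _ ⟩
    x ∙ (y ∙ (x ^ n ∙ y ^ n))   ≡⟨ cong (x ∙_) (assoc y _ _) ⟨
    x ∙ ((y ∙ x ^ n) ∙ y ^ n)   ≡⟨ cong (λ z → x ∙ (z ∙ y ^ n)) (commute-^ʳ n (sym xy≡yx)) ⟩
    x ∙ ((x ^ n ∙ y) ∙ y ^ n)   ≡⟨ cong (x ∙_) (assoc _ y _) ⟩
    x ∙ (x ^ n ∙ (y ∙ y ^ n))   ≡⟨ assoc x _ _ ⟨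
    (x ∙ x ^ n) ∙ (y ∙ y ^ n)   ∎

  module Translation (g : Carrier) where
    open Iteration _≟_ (g ∙_) (∙-cancelˡ g _ _) public

    iter≡^∙ : ∀ k x → iter k x ≡ g ^ k ∙ x
    iter≡^∙ zero    x = sym (identityˡ x)
    iter≡^∙ (suc k) x = trans (cong (g ∙_) (iter≡^∙ k x)) (sym (assoc g _ x))

    ^≡ε⇒iter≡ : ∀ k x → g ^ k ≡ ε → iter k x ≡ x
    ^≡ε⇒iter≡ k x g^k≡ε = trans (iter≡^∙ k x) (trans (cong (_∙ x) g^k≡ε) (identityˡ x))

    iter≡⇒^≡ε : ∀ k x → iter k x ≡ x → g ^ k ≡ ε
    iter≡⇒^≡ε k x fix = ∙-cancelʳ x _ _ (trans (sym (iter≡^∙ k x)) (trans fix (sym (identityˡ x))))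

    order⇒period : ∀ {k} x → HasOrder G g k → IsPeriod x k
    order⇒period {k} x (k>0 , g^k≡ε , min) =
      k>0 , ^≡ε⇒iter≡ k x g^k≡ε , λ j j>0 fix → min j j>0 (iter≡⇒^≡ε j x fix)

    period⇒order : ∀ {k} → IsPeriod ε k → HasOrder G g k
    period⇒order {k} (k>0 , fix , min) =
      k>0 , iter≡⇒^≡ε k ε fix , λ j j>0 g^j≡ε → min j j>0 (^≡ε⇒iter≡ j ε g^j≡ε)

  -- Abstract, so that ord (found by a search) is never unfolded during type checking.
  abstract
    order-exists : ∀ g → ∃ (HasOrder G g)
    order-exists g with pigeonhole (n<1+n order) (λ (i : Fin (suc order)) → g ^ toℕ i)
    ... | i , j , i<j , g^i≡g^j =
      let d , period = period-exists (toℕ j ∸ toℕ i) (m<n⇒0<n∸m i<j)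
                         (iter-∸ (toℕ i) (toℕ j) (<⇒≤ i<j)
                           (trans (iter≡^∙ (toℕ i) ε) (trans (cong (_∙ ε) g^i≡g^j) (sym (iter≡^∙ (toℕ j) ε)))))
      in d , period⇒order period
      where open Translation g

  ord : Carrier → ℕ
  ord g = proj₁ (order-exists g)

  ord-HasOrder : ∀ g → HasOrder G g (ord g)
  ord-HasOrder g = proj₂ (order-exists g)

  order-unique : ∀ {g a b} → HasOrder G g a → HasOrder G g b → a ≡ b
  order-unique (a>0 , g^a≡ε , min-a) (b>0 , g^b≡ε , min-b) = ≤-antisym (min-a _ b>0 g^b≡ε) (min-b _ a>0 g^a≡ε)

  order-∣ : ∀ {g a} n → HasOrder G g a → g ^ n ≡ ε → a ∣ n
  order-∣ {g} n g-order g^n≡ε = period-∣ n (order⇒period ε g-order) (^≡ε⇒iter≡ n ε g^n≡ε)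
    where open Translation g

  ^-*-ε : ∀ {g n} t → g ^ n ≡ ε → g ^ (t * n) ≡ ε
  ^-*-ε {g} {n} t g^n≡ε = begin
    g ^ (t * n)   ≡⟨ ^-^ g n t ⟨
    (g ^ n) ^ t   ≡⟨ cong (_^ t) g^n≡ε ⟩
    ε ^ t         ≡⟨ ε-^ t ⟩
    ε             ∎

  ^-multiple≡ε : ∀ {g a} n → HasOrder G g a → a ∣ n → g ^ n ≡ ε
  ^-multiple≡ε _ (_ , g^a≡ε , _) (divides t refl) = ^-*-ε t g^a≡ε

  order-^ : ∀ {g} d t → 0 < t → HasOrder G g (d * t) → HasOrder G (g ^ t) d
  order-^ zero t _ (() , _)
  order-^ {g} d@(suc _) t t>0 g-order =
    z<s , trans (^-^ g t d) (^-multiple≡ε (d * t) g-order ∣-refl) , min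
    where
    min : ∀ j → 0 < j → (g ^ t) ^ j ≡ ε → d ≤ j
    min j j>0 e = ∣⇒≤ ⦃ >-nonZero j>0 ⦄
      (*-cancelʳ-∣ t ⦃ >-nonZero t>0 ⦄ (order-∣ (j * t) g-order (trans (sym (^-^ g t j)) e)))

  order-^-∣ : ∀ {g a b} t → HasOrder G g a → HasOrder G (g ^ t) b → b ∣ a
  order-^-∣ {g} {a} t g-order g^t-order =
    order-∣ a g^t-order (trans (^-^ g t a) (^-multiple≡ε (a * t) g-order (m∣m*n t)))

  order-∙-coprime : ∀ {x y a b} → Commute x y → Coprime a b → HasOrder G x a → HasOrder G y b → HasOrder G (x ∙ y) (a * b)
  order-∙-coprime {x} {y} {a} {b} xy≡yx a⊥b x-order@(a>0 , _ , _) y-order@(b>0 , _ , _) =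
    *-mono-≤ a>0 b>0 , xy^ab≡ε , λ j j>0 e → ∣⇒≤ ⦃ >-nonZero j>0 ⦄
      (coprime-∣-* a⊥b (coprime-divisor a⊥b (order-∣ (b * j) x-order (x^bj≡ε j e)))
                       (coprime-divisor (Coprimality.sym a⊥b) (order-∣ (a * j) y-order (y^aj≡ε j e))))
    where
    xy^ab≡ε : (x ∙ y) ^ (a * b) ≡ ε
    xy^ab≡ε = begin
      (x ∙ y) ^ (a * b)          ≡⟨ ∙-^ (a * b) xy≡yx ⟩
      x ^ (a * b) ∙ y ^ (a * b)  ≡⟨ cong₂ _∙_ (^-multiple≡ε _ x-order (m∣m*n b))
                                              (^-multiple≡ε _ y-order (n∣m*n a)) ⟩
      ε ∙ ε                      ≡⟨ identityˡ ε ⟩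
      ε                          ∎
    x^bj≡ε : ∀ j → (x ∙ y) ^ j ≡ ε → x ^ (b * j) ≡ ε
    x^bj≡ε j e = begin
      x ^ (b * j)                ≡⟨ identityʳ _ ⟨
      x ^ (b * j) ∙ ε            ≡⟨ cong (x ^ (b * j) ∙_) (^-multiple≡ε (b * j) y-order (m∣m*n j)) ⟨
      x ^ (b * j) ∙ y ^ (b * j)  ≡⟨ ∙-^ (b * j) xy≡yx ⟨
      (x ∙ y) ^ (b * j)          ≡⟨ ^-*-ε b e ⟩
      ε                          ∎
    y^aj≡ε : ∀ j → (x ∙ y) ^ j ≡ ε → y ^ (a * j) ≡ ε
    y^aj≡ε j e = begin
      y ^ (a * j)                ≡⟨ identityˡ _ ⟨
      ε ∙ y ^ (a * j)            ≡⟨ cong (_∙ y ^ (a * j)) (^-multiple≡ε (a * j) x-order (m∣m*n j)) ⟨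
      x ^ (a * j) ∙ y ^ (a * j)  ≡⟨ ∙-^ (a * j) xy≡yx ⟨
      (x ∙ y) ^ (a * j)          ≡⟨ ^-*-ε a e ⟩
      ε                          ∎

  lagrange : ∀ g → ord g ∣ order
  lagrange g = subst (ord g ∣_) count-U
    (Orbits.period-∣-count (g ∙_) (∙-cancelˡ g _ _) (ord g) U? (λ _ _ → tt)
      (λ x _ → Translation.order⇒period g x (ord-HasOrder g)))

  IsPowerOf-refl : ∀ g → IsPowerOf G g g
  IsPowerOf-refl g = 1 , sym (^-1 g)

  IsPowerOf-trans : ∀ {x y z} → IsPowerOf G x y → IsPowerOf G y z → IsPowerOf G x z
  IsPowerOf-trans {z = z} (i , refl) (j , refl) = i * j , ^-^ z j i

  ⁻¹-IsPowerOf : ∀ g → IsPowerOf G (g ⁻¹) g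
  ⁻¹-IsPowerOf g = ord g ∸ 1 , sym (inverseˡ-unique _ g (begin
    g ^ (ord g ∸ 1) ∙ g       ≡⟨ cong (g ^ (ord g ∸ 1) ∙_) (^-1 g) ⟨
    g ^ (ord g ∸ 1) ∙ g ^ 1   ≡⟨ ^-+ g (ord g ∸ 1) 1 ⟨
    g ^ (ord g ∸ 1 + 1)       ≡⟨ cong (g ^_) (m∸n+n≡m (proj₁ (ord-HasOrder g))) ⟩
    g ^ ord g                 ≡⟨ proj₁ (proj₂ (ord-HasOrder g)) ⟩
    ε                         ∎))

  gcd-IsPowerOf : ∀ {z N} a → z ^ N ≡ ε → IsPowerOf G (z ^ gcd a N) (z ^ a)
  gcd-IsPowerOf {z} {N} a z^N≡ε with Bézout.identity (gcd-GCD a N)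
  ... | Bézout.+- x y d+yN≡xa = x , (begin
    z ^ d                  ≡⟨ identityʳ _ ⟨
    z ^ d ∙ ε              ≡⟨ cong (z ^ d ∙_) (^-*-ε y z^N≡ε) ⟨
    z ^ d ∙ z ^ (y * N)    ≡⟨ ^-+ z d (y * N) ⟨
    z ^ (d + y * N)        ≡⟨ cong (z ^_) d+yN≡xa ⟩
    z ^ (x * a)            ≡⟨ ^-^ z a x ⟨
    (z ^ a) ^ x            ∎)
    where d = gcd a N
  ... | Bézout.-+ x y d+xa≡yN = IsPowerOf-trans
    (subst (λ w → IsPowerOf G w ((z ^ a) ^ x)) (sym (inverseˡ-unique _ _ (begin
      z ^ d ∙ (z ^ a) ^ x  ≡⟨ cong (z ^ d ∙_) (^-^ z a x) ⟩
      z ^ d ∙ z ^ (x * a)  ≡⟨ ^-+ z d (x * a) ⟨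
      z ^ (d + x * a)      ≡⟨ cong (z ^_) d+xa≡yN ⟩
      z ^ (y * N)          ≡⟨ ^-*-ε y z^N≡ε ⟩
      ε                    ∎))) (⁻¹-IsPowerOf _))
    (x , refl)
    where d = gcd a N

  power-of-same-order-generates : ∀ {w N} i → HasOrder G w N → HasOrder G (w ^ i) N → IsPowerOf G w (w ^ i)
  power-of-same-order-generates {w} {N} i (N>0 , w^N≡ε , _) (_ , _ , min) =
    subst (λ v → IsPowerOf G v (w ^ i)) (trans (cong (w ^_) (coprime⇒gcd≡1 i⊥N)) (^-1 w)) (gcd-IsPowerOf i w^N≡ε)
    where
    i⊥N : Coprime i N
    i⊥N {zero}        (_ , divides N′ N≡N′*0) = contradiction (trans N≡N′*0 (*-zeroʳ N′)) (>⇒≢ N>0)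
    i⊥N {suc zero}    _                       = refl
    i⊥N {suc (suc _)} (_ , divides zero refl) = contradiction N>0 (<-irrefl refl)
    i⊥N {c@(suc (suc _))} (divides i′ refl , divides N′@(suc _) refl) =
      contradiction (min N′ z<s w^ic^N′≡ε) (<⇒≱ (m<m*n N′ c (s≤s (s≤s z≤n))))
      where
      w^ic^N′≡ε : (w ^ (i′ * c)) ^ N′ ≡ ε
      w^ic^N′≡ε = begin
        (w ^ (i′ * c)) ^ N′   ≡⟨ ^-^ w (i′ * c) N′ ⟩
        w ^ (N′ * (i′ * c))   ≡⟨ cong (w ^_) (x∙yz≈y∙xz N′ i′ c) ⟩
        w ^ (i′ * (N′ * c))   ≡⟨ ^-*-ε i′ w^N≡ε ⟩
        ε                     ∎

  max-order-element : ∃[ z ] ∀ g → ord g ≤ ord z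
  max-order-element = argmax ord ε (allFin order) ,
    λ g → All.lookup (f[xs]≤f[argmax] {f = ord} ε (allFin order)) (∈-allFin g)

  prime-order : ∀ {g q} → Prime q → g ^ q ≡ ε → ¬ g ≡ ε → HasOrder G g q
  prime-order {g} q-prime g^q≡ε g≢ε with prime⇒irreducible q-prime (order-∣ _ (ord-HasOrder g) g^q≡ε)
  ... | inj₂ ord≡q = subst (HasOrder G g) ord≡q (ord-HasOrder g)
  ... | inj₁ ord≡1 =
    contradiction (trans (sym (^-1 g)) (subst (λ k → g ^ k ≡ ε) ord≡1 (proj₁ (proj₂ (ord-HasOrder g))))) g≢ε

module Cauchy (G : FiniteGroup) where
  open import Algebra.Structures using (IsGroup)
  open import Data.Nat as ℕ using (zero; suc; z<s; >-nonZero)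
  open import Data.Nat.Properties using (≤-trans; ≤-reflexive; ≤-antisym; ≤-pred; +-comm)
  open import Data.Nat.Divisibility using (_∣_; ∣⇒≤; ∣m+n∣m⇒∣n)
  open import Data.Nat.Primality using (Prime; prime⇒irreducible; ¬prime[0])
  open import Data.Nat.GeneralisedArithmetic using (fold)
  open import Data.Fin using (_≟_)
  open import Data.Vec using (Vec; []; _∷_; _∷ʳ_; replicate; head; tail)
  open import Data.Vec.Properties using (∷-injective)
  open import Data.Product using (∃-syntax; proj₁; proj₂)
  open import Data.Sum using (inj₁; inj₂)
  open import Data.Unit using (tt)
  open import Relation.Nullary using (¬_; contradiction)
  open import Relation.Nullary.Decidable using (_×-dec_; ¬?)
  open import Relation.Unary using (Decidable)
  open import Relation.Unary.Properties using (U?)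
  open import Relation.Binary.PropositionalEquality
  open NumberTheory using (prime⇒>1; ∣⇒∣^)
  open Counting
  open Tuples
  open FiniteGroup G
  open IsGroup isGroup using (assoc; identityˡ; identityʳ; inverseˡ)
  open GroupTheory G

  product : ∀ {k} → Vec Carrier k → Carrier
  product []       = ε
  product (x ∷ xs) = x ∙ product xs

  product-∷ʳ : ∀ {k} (xs : Vec Carrier k) x → product (xs ∷ʳ x) ≡ product xs ∙ x
  product-∷ʳ []       x = trans (identityʳ x) (sym (identityˡ x))
  product-∷ʳ (y ∷ xs) x = trans (cong (y ∙_) (product-∷ʳ xs x)) (sym (assoc y _ x))

  product-replicate : ∀ k g → product (replicate k g) ≡ g ^ k
  product-replicate zero    g = refl
  product-replicate (suc k) g = cong (g ∙_) (product-replicate k g)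

  product-rotate : ∀ {k} (v : Vec Carrier (suc k)) → product v ≡ ε → product (rotate v) ≡ ε
  product-rotate (x ∷ xs) x∙∏xs≡ε =
    trans (product-∷ʳ xs x) (trans (cong (_∙ x) (inverseʳ-unique x _ x∙∏xs≡ε)) (inverseˡ x))

  -- McKay's proof of Cauchy's theorem: rotation permutes the (suc k)-tuples with product ε, the moving
  -- ones in orbits of size suc k, so suc k divides the number of constant ones.
  module McKay (k : ℕ) where

    tuple : Fin (order ℕ.^ suc k) → Vec Carrier (suc k)
    tuple = decode (suc k)

    σ : Fin (order ℕ.^ suc k) → Fin (order ℕ.^ suc k)
    σ c = encode (rotate (tuple c))

    σ-injective : ∀ {c c′} → σ c ≡ σ c′ → c ≡ c′
    σ-injective e = decode-injective {order} (suc k) (rotate-injective (encode-injective e))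

    open Iteration _≟_ σ σ-injective public

    iter-σ : ∀ j c → iter j c ≡ encode (fold (tuple c) rotate j)
    iter-σ zero    c = sym (encode-decode {order} (suc k) c)
    iter-σ (suc j) c = trans (cong σ (iter-σ j c)) (cong (encode ∘ rotate) (decode-encode (fold (tuple c) rotate j)))

    iter-σ-length : ∀ c → iter (suc k) c ≡ c
    iter-σ-length c = trans (iter-σ (suc k) c) (trans (cong encode (rotate^length≡id (tuple c))) (encode-decode {order} (suc k) c))

    ProductIsε : Fin (order ℕ.^ suc k) → Set
    ProductIsε c = product (tuple c) ≡ ε

    ProductIsε? : Decidable ProductIsε
    ProductIsε? c = product (tuple c) ≟ ε

    count-ProductIsε : count ProductIsε? ≡ order ℕ.^ k
    count-ProductIsε = ≤-antisym
      (≤-trans (count-≤-injection ProductIsε? U? (λ c _ → encode (tail (tuple c))) (λ _ _ → tt)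
                 (λ c c′ ∏≡ε ∏′≡ε e → decode-injective {order} (suc k)
                                        (same-tail (tuple c) (tuple c′) ∏≡ε ∏′≡ε (encode-injective e))))
               (≤-reflexive count-U))
      (≤-trans (≤-reflexive (sym count-U))
               (count-≤-injection U? ProductIsε? (λ c _ → encode (product (decode k c) ⁻¹ ∷ decode k c))
                 (λ c _ → trans (cong product (decode-encode (product (decode k c) ⁻¹ ∷ decode k c))) (inverseˡ _))
                 (λ c c′ _ _ e → decode-injective {order} k (proj₂ (∷-injective (encode-injective e))))))
      where
      same-tail : ∀ (v w : Vec Carrier (suc k)) → product v ≡ ε → product w ≡ ε → tail v ≡ tail w → v ≡ w
      same-tail (x ∷ xs) (y ∷ .xs) x∙∏≡ε y∙∏≡ε refl =
        cong (_∷ xs) (∙-cancelʳ (product xs) x y (trans x∙∏≡ε (sym y∙∏≡ε)))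

    Fixed : Fin (order ℕ.^ suc k) → Set
    Fixed c = σ c ≡ c

    Fixed? : Decidable Fixed
    Fixed? c = σ c ≟ c

    moving-period : Prime (suc k) → ∀ c → ¬ Fixed c → IsPeriod c (suc k)
    moving-period q-prime c moves with period-exists (suc k) z<s (iter-σ-length c)
    ... | d , d-period with prime⇒irreducible q-prime (period-∣ (suc k) d-period (iter-σ-length c))
    ...   | inj₂ refl = d-period
    ...   | inj₁ refl = contradiction (proj₁ (proj₂ d-period)) moves

    ProductIsε∧Fixed? : Decidable (λ c → ProductIsε c × Fixed c)
    ProductIsε∧Fixed? c = ProductIsε? c ×-dec Fixed? c

    ProductIsε∧Moving? : Decidable (λ c → ProductIsε c × ¬ Fixed c)
    ProductIsε∧Moving? c = ProductIsε? c ×-dec ¬? (Fixed? c)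

    ∣-count-ProductIsε∧Fixed : Prime (suc k) → suc k ∣ order → suc k ∣ count ProductIsε∧Fixed?
    ∣-count-ProductIsε∧Fixed q-prime q∣order = ∣m+n∣m⇒∣n
      (subst (suc k ∣_) (trans (sym count-ProductIsε)
                               (trans (count-split ProductIsε? Fixed?) (+-comm _ (count ProductIsε∧Moving?))))
             (∣⇒∣^ k (≤-pred (prime⇒>1 q-prime)) q∣order))
      (Orbits.period-∣-count σ σ-injective (suc k) ProductIsε∧Moving?
        (λ c (c∈X , moves) → trans (cong product (decode-encode (rotate (tuple c)))) (product-rotate (tuple c) c∈X) ,
                              moves ∘ σ-injective)
        (λ c (_ , moves) → moving-period q-prime c moves))

    trivial : Fin (order ℕ.^ suc k)
    trivial = encode (replicate (suc k) ε)

    trivial-ProductIsε∧Fixed : ProductIsε trivial × Fixed trivial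
    trivial-ProductIsε∧Fixed =
      trans (cong product (decode-encode (replicate (suc k) ε))) (trans (product-replicate (suc k) ε) (ε-^ (suc k))) ,
      cong encode (trans (cong rotate (decode-encode (replicate (suc k) ε))) (rotate-replicate k ε))

    element-of-prime-order : Prime (suc k) → suc k ∣ order → ∃[ g ] HasOrder G g (suc k)
    element-of-prime-order q-prime q∣order
      with count≥2⇒∃≢ ProductIsε∧Fixed?
             (≤-trans (prime⇒>1 q-prime) (∣⇒≤ ⦃ >-nonZero (∈⇒count>0 ProductIsε∧Fixed? trivial-ProductIsε∧Fixed) ⦄
                                              (∣-count-ProductIsε∧Fixed q-prime q∣order)))
             trivial
    ... | c , (c∈X , c-fixed) , c≢trivial = g , prime-order q-prime g^q≡ε g≢ε
      where
      g = head (tuple c)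
      tuple-c≡replicate : tuple c ≡ replicate (suc k) g
      tuple-c≡replicate = rotate-fixed⇒replicate (tuple c) (trans (sym (decode-encode (rotate (tuple c)))) (cong tuple c-fixed))
      g^q≡ε : g ^ suc k ≡ ε
      g^q≡ε = trans (sym (product-replicate (suc k) g)) (trans (cong product (sym tuple-c≡replicate)) c∈X)
      g≢ε : ¬ g ≡ ε
      g≢ε g≡ε = c≢trivial (trans (sym (encode-decode {order} (suc k) c))
                                 (cong encode (trans tuple-c≡replicate (cong (replicate (suc k)) g≡ε))))

  cauchy : ∀ q → Prime q → q ∣ order → ∃[ g ] HasOrder G g q
  cauchy zero    q-prime = contradiction q-prime ¬prime[0]
  cauchy (suc k)         = McKay.element-of-prime-order k

module Conjugation (G : FiniteGroup) where
  open import Algebra.Structures using (IsGroup)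
  open import Data.Nat using (_+_; _*_; _∸_; _≤_)
  open import Data.Nat.Properties hiding (_≟_)
  open import Data.Fin using (_≟_)
  open import Data.Product using (∃-syntax; proj₁; proj₂)
  open import Relation.Unary using (Decidable)
  open import Relation.Binary.PropositionalEquality
  open import Algebra.Properties.CommutativeMonoid.Sum +-0-commutativeMonoid using (sum; ∑-comm)
  open Counting
  open FiniteGroup G
  open IsGroup isGroup using (assoc; identityˡ; identityʳ; inverseˡ; inverseʳ)
  open GroupTheory G

  conj : Carrier → Carrier → Carrier
  conj x u = x ⁻¹ ∙ u ∙ x

  conj-∙ : ∀ x a b → conj x (a ∙ b) ≡ conj x a ∙ conj x b
  conj-∙ x a b = begin
    x ⁻¹ ∙ (a ∙ b) ∙ x                      ≡⟨ cong (_∙ x) (assoc _ a b) ⟨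
    x ⁻¹ ∙ a ∙ b ∙ x                        ≡⟨ cong (λ u → x ⁻¹ ∙ a ∙ u ∙ x) (identityˡ b) ⟨
    x ⁻¹ ∙ a ∙ (ε ∙ b) ∙ x                  ≡⟨ cong (λ u → x ⁻¹ ∙ a ∙ (u ∙ b) ∙ x) (inverseʳ x) ⟨
    x ⁻¹ ∙ a ∙ (x ∙ x ⁻¹ ∙ b) ∙ x           ≡⟨ cong (λ u → x ⁻¹ ∙ a ∙ u ∙ x) (assoc x _ b) ⟩
    x ⁻¹ ∙ a ∙ (x ∙ (x ⁻¹ ∙ b)) ∙ x         ≡⟨ cong (_∙ x) (assoc _ x _) ⟨
    x ⁻¹ ∙ a ∙ x ∙ (x ⁻¹ ∙ b) ∙ x           ≡⟨ assoc _ _ x ⟩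
    x ⁻¹ ∙ a ∙ x ∙ (x ⁻¹ ∙ b ∙ x)           ∎
    where open ≡-Reasoning

  conj-∙ˡ : ∀ k x u → conj (k ∙ x) u ≡ conj x (conj k u)
  conj-∙ˡ k x u = begin
    (k ∙ x) ⁻¹ ∙ u ∙ (k ∙ x)     ≡⟨ cong (λ v → v ∙ u ∙ (k ∙ x)) (⁻¹-anti-homo-∙ k x) ⟩
    x ⁻¹ ∙ k ⁻¹ ∙ u ∙ (k ∙ x)    ≡⟨ assoc _ k x ⟨
    x ⁻¹ ∙ k ⁻¹ ∙ u ∙ k ∙ x      ≡⟨ cong (λ v → v ∙ k ∙ x) (assoc _ _ u) ⟩
    x ⁻¹ ∙ (k ⁻¹ ∙ u) ∙ k ∙ x    ≡⟨ cong (_∙ x) (assoc _ _ k) ⟩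
    x ⁻¹ ∙ (k ⁻¹ ∙ u ∙ k) ∙ x    ∎
    where open ≡-Reasoning

  conj-ε : ∀ u → conj ε u ≡ u
  conj-ε u = trans (cong (λ v → v ∙ u ∙ ε) ε⁻¹≈ε) (trans (identityʳ _) (identityˡ u))

  conj-⁻¹ : ∀ x u → conj (x ⁻¹) (conj x u) ≡ u
  conj-⁻¹ x u = trans (sym (conj-∙ˡ x (x ⁻¹) u)) (trans (cong (λ v → conj v u) (inverseʳ x)) (conj-ε u))

  conj-injective : ∀ x {u v} → conj x u ≡ conj x v → u ≡ v
  conj-injective x {u} {v} e = trans (sym (conj-⁻¹ x u)) (trans (cong (conj (x ⁻¹)) e) (conj-⁻¹ x v))

  conj-Commute : ∀ x {a b} → Commute a b → Commute (conj x a) (conj x b)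
  conj-Commute x {a} {b} ab≡ba = trans (sym (conj-∙ x a b)) (trans (cong (conj x) ab≡ba) (conj-∙ x b a))

  Commute⇒conj≡ : ∀ {k g} → Commute k g → conj k g ≡ g
  Commute⇒conj≡ {k} {g} kg≡gk = begin
    k ⁻¹ ∙ g ∙ k      ≡⟨ assoc _ g k ⟩
    k ⁻¹ ∙ (g ∙ k)    ≡⟨ cong (k ⁻¹ ∙_) kg≡gk ⟨
    k ⁻¹ ∙ (k ∙ g)    ≡⟨ assoc _ k g ⟨
    k ⁻¹ ∙ k ∙ g      ≡⟨ cong (_∙ g) (inverseˡ k) ⟩
    ε ∙ g             ≡⟨ identityˡ g ⟩
    g                 ∎
    where open ≡-Reasoning

  -- Double count the pairs (x , h) with h commuting with conj x g: each x gives at most |C(g)| of them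
  -- (conjugate back into C(g)), each h at least |C(g)| (translate x by C(g)), and h = ε gives |G|.
  centraliser-conjugates-cover⇒central : ∀ g → (∀ h → ∃[ x ] Commute h (conj x g)) → ∀ h → Commute h g
  centraliser-conjugates-cover⇒central g cover = N≤count⇒all C? order≤c
    where
    C? : Decidable (λ h → Commute h g)
    C? h = h ∙ g ≟ g ∙ h
    R? : ∀ x → Decidable (λ h → Commute h (conj x g))
    R? x h = h ∙ conj x g ≟ conj x g ∙ h
    c = count C?

    count-R≤c : ∀ x → count (R? x) ≤ c
    count-R≤c x = count-≤-injection (R? x) C? (λ h _ → conj (x ⁻¹) h)
      (λ h h-R → subst (Commute (conj (x ⁻¹) h)) (conj-⁻¹ x g) (conj-Commute (x ⁻¹) h-R))
      (λ _ _ _ _ → conj-injective (x ⁻¹))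

    c≤count-R : ∀ h → c ≤ count (λ x → R? x h)
    c≤count-R h = count-≤-injection C? (λ x → R? x h) (λ k _ → k ∙ x₀)
      (λ k k-C → subst (Commute h) (sym (trans (conj-∙ˡ k x₀ g) (cong (conj x₀) (Commute⇒conj≡ k-C)))) h-R)
      (λ _ _ _ _ → ∙-cancelʳ x₀ _ _)
      where
      x₀ = proj₁ (cover h)
      h-R = proj₂ (cover h)

    count-Rε : count (λ x → R? x ε) ≡ order
    count-Rε = count-all (λ x → R? x ε) (λ x → trans (identityˡ _) (sym (identityʳ _)))

    order≤c : order ≤ c
    order≤c = m∸n≡0⇒m≤n (n≤0⇒n≡0 (+-cancelˡ-≤ (order * c) (order ∸ c) 0 (begin
      order * c + (order ∸ c)           ≤⟨ N*c+d≤sum ε c≤count-R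
                                             (≤-reflexive (trans (m+[n∸m]≡n (count-≤ C?)) (sym count-Rε))) ⟩
      sum (λ h → count (λ x → R? x h))  ≡⟨ ∑-comm (λ h x → indicator (R? x h)) ⟩
      sum (λ x → count (R? x))          ≤⟨ sum-mono-≤ count-R≤c ⟩
      sum {order} (λ _ → c)             ≡⟨ sum-const order c ⟩
      order * c                         ≡⟨ +-identityʳ _ ⟨
      order * c + 0                     ∎)))
      where open ≤-Reasoning

module CompleteGraphs (G : FiniteGroup) where
  open import Data.Nat as ℕ using (zero; suc; _*_; _≤_; _<_; z<s; >-nonZero; >-nonZero⁻¹)
  open import Data.Nat.Properties hiding (_≟_)
  open import Data.Nat.Divisibility using (_∣_; divides; _∣?_; ∣-refl; ∣-reflexive; ∣-trans; ∣⇒≤)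
  open import Data.Nat.GCD using (gcd[m,n]∣m; gcd[m,n]∣n)
  open import Data.Nat.Primality using (Prime; prime[2])
  open import Data.Fin using (_≟_)
  open import Data.Fin.Properties using (nonZeroIndex)
  open import Data.Product using (∃-syntax; proj₁; proj₂)
  open import Data.Sum using (_⊎_; inj₁; inj₂; swap; map₂; [_,_]′)
  open import Relation.Nullary using (¬_; yes; no; contradiction)
  open import Relation.Binary.PropositionalEquality
  open NumberTheory
  open FiniteGroup G
  open GroupTheory G
  open Conjugation G
  open Cauchy G using (cauchy)

  Conjugate-refl : ∀ g → Conjugate G g g
  Conjugate-refl g = ε , sym (conj-ε g)

  SameOrder-refl : ∀ g → SameOrder G g g
  SameOrder-refl g = ord g , ord-HasOrder g , ord-HasOrder g

  complete⇒Super-complete : {B : Carrier → Carrier → Set} {A : Graph G} → (∀ g → B g g) →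
                            Complete G A → Complete G (Super G B A)
  complete⇒Super-complete B-refl complete g h g≢h = g≢h , g , h , B-refl g , B-refl h , inj₂ (complete g h g≢h)

  Super-mono : {B : Carrier → Carrier → Set} {A A′ : Graph G} → (∀ {g h} → A g h → A′ g h) →
               ∀ {g h} → Super G B A g h → Super G B A′ g h
  Super-mono A⇒A′ (g≢h , g′ , h′ , g~g′ , h~h′ , edge) = g≢h , g′ , h′ , g~g′ , h~h′ , map₂ A⇒A′ edge

  Super-complete-mono : {B : Carrier → Carrier → Set} {A A′ : Graph G} → (∀ {g h} → A g h → A′ g h) →
                        Complete G (Super G B A) → Complete G (Super G B A′)
  Super-complete-mono A⇒A′ complete g h = Super-mono A⇒A′ ∘ complete g h

  Super-sym : {B : Carrier → Carrier → Set} {A : Graph G} → (∀ {g h} → A g h → A h g) →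
              ∀ {g h} → Super G B A g h → Super G B A h g
  Super-sym A-sym (g≢h , g′ , h′ , g~g′ , h~h′ , edge) =
    g≢h ∘ sym , h′ , g′ , h~h′ , g~g′ , [ inj₁ ∘ sym , inj₂ ∘ A-sym ]′ edge

  power⇒enhanced : ∀ {g h} → PowerGraph G g h → EnhancedPowerGraph G g h
  power⇒enhanced {g} {h} (g≢h , inj₁ g∈⟨h⟩) = g≢h , h , g∈⟨h⟩ , IsPowerOf-refl h
  power⇒enhanced {g} {h} (g≢h , inj₂ h∈⟨g⟩) = g≢h , g , IsPowerOf-refl g , h∈⟨g⟩

  enhanced⇒commuting : ∀ {g h} → EnhancedPowerGraph G g h → CommutingGraph G g h
  enhanced⇒commuting (g≢h , z , (i , refl) , (j , refl)) = g≢h , commute-^ i j refl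

  equal-or-commuting⇒Commute : ∀ {g h} → g ≡ h ⊎ CommutingGraph G g h → Commute g h
  equal-or-commuting⇒Commute (inj₁ refl)     = refl
  equal-or-commuting⇒Commute (inj₂ (_ , gh≡hg)) = gh≡hg

  commuting-complete⇒abelian : Complete G (CommutingGraph G) → IsAbelian G
  commuting-complete⇒abelian complete a b with a ≟ b
  ... | yes refl = refl
  ... | no a≢b   = proj₂ (complete a b a≢b)

  abelian⇒commuting-complete : IsAbelian G → Complete G (CommutingGraph G)
  abelian⇒commuting-complete abelian g h g≢h = g≢h , abelian g h

  Super-Conjugate-commuting-complete⇒abelian : Complete G (Super G (Conjugate G) (CommutingGraph G)) → IsAbelian G
  Super-Conjugate-commuting-complete⇒abelian complete a b = centraliser-conjugates-cover⇒central b (cover b) a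
    where
    cover : ∀ g h → ∃[ x ] Commute h (conj x g)
    cover g h with h ≟ g
    ... | yes refl = ε , subst (Commute h) (sym (conj-ε h)) refl
    ... | no h≢g with complete h g h≢g
    ...   | _ , _ , _ , (x , refl) , (y , refl) , edge = y ∙ x ⁻¹ ,
      subst₂ Commute (conj-⁻¹ x h) (sym (conj-∙ˡ y (x ⁻¹) g)) (conj-Commute (x ⁻¹) (equal-or-commuting⇒Commute edge))

  Super-Conjugate-complete⇒complete : {A : Graph G} → (∀ {g h} → A g h → CommutingGraph G g h) →
                                      Complete G (Super G (Conjugate G) A) → Complete G A
  Super-Conjugate-complete⇒complete {A} A⇒commuting complete g h g≢h with complete g h g≢h
  ... | _ , _ , _ , (x , refl) , (y , refl) , edge =
    [ (λ g′≡h′ → contradiction (trans (sym (central x g)) (trans g′≡h′ (central y h))) g≢h)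
    , subst₂ A (central x g) (central y h) ]′ edge
    where
    central : ∀ x g → conj x g ≡ g
    central x g = Commute⇒conj≡ (Super-Conjugate-commuting-complete⇒abelian (Super-complete-mono A⇒commuting complete) x g)

  -- If a ∤ M, some q ^ e ∣ a has q ^ e ∤ M = q ^ f * M′ with q ∤ M′, and then x ^ t ∙ y ^ (q ^ f)
  -- has order q ^ e * M′ > M.
  Commute⇒order-∣-max-order : ∀ {x y a M} → Commute x y → HasOrder G x a → HasOrder G y M →
                              (∀ g → ord g ≤ M) → a ∣ M
  Commute⇒order-∣-max-order {x} {y} {a} {M} xy≡yx x-order@(a>0 , _ , _) y-order@(M>0 , _ , _) max with a ∣? M
  ... | yes a∣M = a∣M
  ... | no a∤M with ∤⇒prime-power-∤ a a>0 a∤M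
  ...   | q , q-prime , e , divides zero a≡0 , _ = contradiction a≡0 (>⇒≢ a>0)
  ...   | q , q-prime , e , divides t@(suc _) a≡t*q^e , q^e∤M with valuation q-prime M M>0
  ...     | f , M′ , M≡q^f*M′ , q∤M′ = contradiction (max (x ^ t ∙ y ^ (q ℕ.^ f))) (<⇒≱ M<ord)
    where
    q>1 = prime⇒>1 q-prime
    M′>0 : 0 < M′
    M′>0 = n≢0⇒n>0 (λ { refl → >⇒≢ M>0 (trans M≡q^f*M′ (*-zeroʳ (q ℕ.^ f))) })
    f<e : f < e
    f<e = ≰⇒> (λ e≤f → q^e∤M (∣-trans (^-∣-≤ q e≤f) (divides M′ (trans M≡q^f*M′ (*-comm (q ℕ.^ f) M′)))))
    x^t-order : HasOrder G (x ^ t) (q ℕ.^ e)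
    x^t-order = order-^ (q ℕ.^ e) t z<s (subst (HasOrder G x) (trans a≡t*q^e (*-comm t (q ℕ.^ e))) x-order)
    y^q^f-order : HasOrder G (y ^ (q ℕ.^ f)) M′
    y^q^f-order = order-^ M′ (q ℕ.^ f) (m^n>0 q ⦃ >-nonZero (<-trans z<s q>1) ⦄ f)
                    (subst (HasOrder G y) (trans M≡q^f*M′ (*-comm (q ℕ.^ f) M′)) y-order)
    M<ord : M < ord (x ^ t ∙ y ^ (q ℕ.^ f))
    M<ord = begin-strict
      M                         ≡⟨ M≡q^f*M′ ⟩
      q ℕ.^ f * M′              <⟨ *-monoˡ-< M′ ⦃ >-nonZero M′>0 ⦄ (^-monoʳ-< q q>1 f<e) ⟩
      q ℕ.^ e * M′              ≡⟨ order-unique (order-∙-coprime (commute-^ t (q ℕ.^ f) xy≡yx) (coprime-^ q-prime q∤M′ e)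
                                                                x^t-order y^q^f-order)
                                                (ord-HasOrder _) ⟩
      ord (x ^ t ∙ y ^ (q ℕ.^ f)) ∎
      where open ≤-Reasoning

  Super-SameOrder-commuting-complete⇒order-∣-max-order :
    Complete G (Super G (SameOrder G) (CommutingGraph G)) → ∀ {z} → (∀ g → ord g ≤ ord z) → ∀ g → ord g ∣ ord z
  Super-SameOrder-commuting-complete⇒order-∣-max-order complete {z} max g with g ≟ z
  ... | yes refl = ∣-refl
  ... | no g≢z with complete g z g≢z
  ...   | _ , g′ , z′ , (k , g-order , g′-order) , (l , z-order , z′-order) , edge =
    subst (_∣ ord z) (order-unique g-order (ord-HasOrder g))
      (Commute⇒order-∣-max-order (equal-or-commuting⇒Commute edge) g′-order
        (subst (HasOrder G z′) (order-unique z-order (ord-HasOrder z)) z′-order) max)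

  Super-SameOrder-commuting-complete⇒element-of-exponent-order :
    ∀ {m} → IsExponent G m → Complete G (Super G (SameOrder G) (CommutingGraph G)) → HasElementOfOrder G m
  Super-SameOrder-commuting-complete⇒element-of-exponent-order {m} (m>0 , g^m≡ε , m-least) complete
    with max-order-element
  ... | z , max = z , subst (HasOrder G z) ord-z≡m (ord-HasOrder z)
    where
    ord-z≡m : ord z ≡ m
    ord-z≡m = ≤-antisym
      (∣⇒≤ ⦃ >-nonZero m>0 ⦄ (order-∣ m (ord-HasOrder z) (g^m≡ε z)))
      (m-least (ord z) (proj₁ (ord-HasOrder z))
        (λ g → ^-multiple≡ε (ord z) (ord-HasOrder g) (Super-SameOrder-commuting-complete⇒order-∣-max-order complete max g)))

  element-of-order-∣ : ∀ {z m d} → HasOrder G z m → d ∣ m → ∃[ t ] HasOrder G (z ^ t) d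
  element-of-order-∣ (m>0 , _) (divides zero m≡0) = contradiction m≡0 (>⇒≢ m>0)
  element-of-order-∣ {z} {d = d} z-order (divides t@(suc _) m≡t*d) =
    t , order-^ d t z<s (subst (HasOrder G z) (trans m≡t*d (*-comm t d)) z-order)

  powers-equal-or-enhanced : ∀ z s t → z ^ s ≡ z ^ t ⊎ EnhancedPowerGraph G (z ^ s) (z ^ t)
  powers-equal-or-enhanced z s t with z ^ s ≟ z ^ t
  ... | yes z^s≡z^t = inj₁ z^s≡z^t
  ... | no z^s≢z^t  = inj₂ (z^s≢z^t , z , (s , refl) , (t , refl))

  element-of-exponent-order⇒Super-SameOrder-enhanced-complete :
    ∀ {m} → IsExponent G m → HasElementOfOrder G m → Complete G (Super G (SameOrder G) (EnhancedPowerGraph G))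
  element-of-exponent-order⇒Super-SameOrder-enhanced-complete {m} (_ , g^m≡ε , _) (z , z-order) g h g≢h
    with element-of-order-∣ z-order (order-∣ m (ord-HasOrder g) (g^m≡ε g))
       | element-of-order-∣ z-order (order-∣ m (ord-HasOrder h) (g^m≡ε h))
  ... | s , z^s-order | t , z^t-order =
    g≢h , z ^ s , z ^ t , (ord g , ord-HasOrder g , z^s-order) , (ord h , ord-HasOrder h , z^t-order) ,
    powers-equal-or-enhanced z s t

  enhanced-complete⇒cyclic : Complete G (EnhancedPowerGraph G) → IsCyclic G
  enhanced-complete⇒cyclic complete with max-order-element
  ... | z , max = z , generates
    where
    generates : ∀ h → IsPowerOf G h z
    generates h with h ≟ z
    ... | yes refl = IsPowerOf-refl h
    ... | no h≢z with complete h z h≢z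
    ...   | _ , w , h∈⟨w⟩ , (i , refl) = IsPowerOf-trans h∈⟨w⟩ (power-of-same-order-generates i (ord-HasOrder w) w^i-order)
      where
      w^i-order : HasOrder G (w ^ i) (ord w)
      w^i-order = subst (HasOrder G (w ^ i))
        (≤-antisym (∣⇒≤ ⦃ >-nonZero (proj₁ (ord-HasOrder w)) ⦄ (order-^-∣ i (ord-HasOrder w) (ord-HasOrder (w ^ i))))
                   (max w))
        (ord-HasOrder (w ^ i))

  cyclic⇒enhanced-complete : IsCyclic G → Complete G (EnhancedPowerGraph G)
  cyclic⇒enhanced-complete (z , generates) g h g≢h = g≢h , z , generates g , generates h

  ∣⇒IsPowerOf : ∀ z {d a} → d ∣ a → IsPowerOf G (z ^ a) (z ^ d)
  ∣⇒IsPowerOf z {d} (divides t refl) = t , sym (^-^ z d t)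

  -- z ^ a and z ^ gcd a (ord z) generate the same subgroup, and that gcd is a power of p.
  same-subgroup-as-p-power : ∀ {p k x} z → Prime p → order ≡ p ℕ.^ k → IsPowerOf G x z →
                             ∃[ i ] IsPowerOf G x (z ^ (p ℕ.^ i)) × IsPowerOf G (z ^ (p ℕ.^ i)) x
  same-subgroup-as-p-power {p} {k} z p-prime order≡p^k (a , refl)
    with ∣p^k⇒≡p^i p-prime k (∣-trans (gcd[m,n]∣n a (ord z)) (subst (ord z ∣_) order≡p^k (lagrange z)))
  ... | i , gcd≡p^i = i ,
    subst (λ d → IsPowerOf G (z ^ a) (z ^ d)) gcd≡p^i (∣⇒IsPowerOf z (gcd[m,n]∣m a (ord z))) ,
    subst (λ d → IsPowerOf G (z ^ d) (z ^ a)) gcd≡p^i (gcd-IsPowerOf a (proj₁ (proj₂ (ord-HasOrder z))))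

  cyclic-p-group⇒power-complete : IsCyclicPGroup G → Complete G (PowerGraph G)
  cyclic-p-group⇒power-complete ((z , generates) , p , p-prime , k , order≡p^k) g h g≢h
    with same-subgroup-as-p-power {k = k} z p-prime order≡p^k (generates g)
       | same-subgroup-as-p-power {k = k} z p-prime order≡p^k (generates h)
  ... | i , g∈⟨z^p^i⟩ , z^p^i∈⟨g⟩ | j , h∈⟨z^p^j⟩ , z^p^j∈⟨h⟩ with ≤-total i j
  ...   | inj₁ i≤j =
    g≢h , inj₂ (IsPowerOf-trans h∈⟨z^p^j⟩ (IsPowerOf-trans (∣⇒IsPowerOf z (^-∣-≤ p i≤j)) z^p^i∈⟨g⟩))
  ...   | inj₂ j≤i =
    g≢h , inj₁ (IsPowerOf-trans g∈⟨z^p^i⟩ (IsPowerOf-trans (∣⇒IsPowerOf z (^-∣-≤ p j≤i)) z^p^j∈⟨h⟩))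

  PowerGraph-sym : ∀ {g h} → PowerGraph G g h → PowerGraph G h g
  PowerGraph-sym (g≢h , edge) = g≢h ∘ sym , swap edge

  order-∣⇒Super-SameOrder-power : ∀ {g h} → ord g ∣ ord h → ¬ g ≡ h → Super G (SameOrder G) (PowerGraph G) g h
  order-∣⇒Super-SameOrder-power {g} {h} ord-g∣ord-h g≢h with element-of-order-∣ (ord-HasOrder h) ord-g∣ord-h
  ... | t , h^t-order = g≢h , h ^ t , h , (ord g , ord-HasOrder g , h^t-order) , SameOrder-refl h , edge
    where
    edge : h ^ t ≡ h ⊎ PowerGraph G (h ^ t) h
    edge with h ^ t ≟ h
    ... | yes h^t≡h = inj₁ h^t≡h
    ... | no h^t≢h  = inj₂ (h^t≢h , inj₁ (t , refl))

  p-group⇒Super-SameOrder-power-complete : IsPGroup G → Complete G (Super G (SameOrder G) (PowerGraph G))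
  p-group⇒Super-SameOrder-power-complete (p , p-prime , k , order≡p^k) g h g≢h
    with ∣p^k⇒≡p^i p-prime k (subst (ord g ∣_) order≡p^k (lagrange g))
       | ∣p^k⇒≡p^i p-prime k (subst (ord h ∣_) order≡p^k (lagrange h))
  ... | i , ord-g≡p^i | j , ord-h≡p^j with ≤-total i j
  ...   | inj₁ i≤j = order-∣⇒Super-SameOrder-power (subst₂ _∣_ (sym ord-g≡p^i) (sym ord-h≡p^j) (^-∣-≤ p i≤j)) g≢h
  ...   | inj₂ j≤i = Super-sym PowerGraph-sym
    (order-∣⇒Super-SameOrder-power (subst₂ _∣_ (sym ord-h≡p^j) (sym ord-g≡p^i) (^-∣-≤ p j≤i)) (g≢h ∘ sym))

  Super-SameOrder-power-complete⇒orders-∣-comparable : Complete G (Super G (SameOrder G) (PowerGraph G)) →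
                                                       ∀ {g h a b} → HasOrder G g a → HasOrder G h b → a ∣ b ⊎ b ∣ a
  Super-SameOrder-power-complete⇒orders-∣-comparable complete {g} {h} g-order h-order with g ≟ h
  ... | yes refl = inj₁ (∣-reflexive (order-unique g-order h-order))
  ... | no g≢h with complete g h g≢h
  ...   | _ , g′ , h′ , (k , g-order′ , g′-order) , (l , h-order′ , h′-order) , edge
    rewrite order-unique g-order g-order′ | order-unique h-order h-order′ with edge
  ...     | inj₁ refl                     = inj₁ (∣-reflexive (order-unique g′-order h′-order))
  ...     | inj₂ (_ , inj₁ (t , refl))    = inj₁ (order-^-∣ t h′-order g′-order)
  ...     | inj₂ (_ , inj₂ (t , refl))    = inj₂ (order-^-∣ t g′-order h′-order)

  Super-SameOrder-power-complete⇒p-group : Complete G (Super G (SameOrder G) (PowerGraph G)) → IsPGroup G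
  Super-SameOrder-power-complete⇒p-group complete with 1 <? order
  ... | no order≯1 = 2 , prime[2] , 0 , ≤-antisym (≮⇒≥ order≯1) (>-nonZero⁻¹ order ⦃ nonZeroIndex ε ⦄)
  ... | yes order>1 with prime-divisor order>1
  ...   | p , p-prime , p∣order =
    p , p-prime , prime-divisors-≡⇒prime-power p-prime ⦃ nonZeroIndex ε ⦄ λ {q} q-prime q∣order →
      let x , x-order = cauchy q q-prime q∣order
          y , y-order = cauchy p p-prime p∣order
      in [ prime-∣-prime⇒≡ q-prime p-prime , sym ∘ prime-∣-prime⇒≡ p-prime q-prime ]′
           (Super-SameOrder-power-complete⇒orders-∣-comparable complete x-order y-order)

  power⇒commuting : ∀ {g h} → PowerGraph G g h → CommutingGraph G g h
  power⇒commuting = enhanced⇒commuting ∘ power⇒enhanced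

  power-complete⇒cyclic-p-group : Complete G (PowerGraph G) → IsCyclicPGroup G
  power-complete⇒cyclic-p-group complete =
    enhanced-complete⇒cyclic (λ g h → power⇒enhanced ∘ complete g h) ,
    Super-SameOrder-power-complete⇒p-group (complete⇒Super-complete SameOrder-refl complete)

mainTheorem5 : (G : FiniteGroup) (m : ℕ) → IsExponent G m →
    ((Complete G (PowerGraph G) ⇔ IsCyclicPGroup G)
     × (Complete G (Super G (Conjugate G) (PowerGraph G)) ⇔ IsCyclicPGroup G)
     × (Complete G (Super G (SameOrder G) (PowerGraph G)) ⇔ IsPGroup G))
    × ((Complete G (EnhancedPowerGraph G) ⇔ IsCyclic G)
     × (Complete G (Super G (Conjugate G) (EnhancedPowerGraph G)) ⇔ IsCyclic G)
     × (Complete G (Super G (SameOrder G) (EnhancedPowerGraph G)) ⇔ HasElementOfOrder G m))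
    × ((Complete G (CommutingGraph G) ⇔ IsAbelian G)
     × (Complete G (Super G (Conjugate G) (CommutingGraph G)) ⇔ IsAbelian G)
     × (Complete G (Super G (SameOrder G) (CommutingGraph G)) ⇔ HasElementOfOrder G m))
mainTheorem5 G m exponent =
  ( mk⇔ power-complete⇒cyclic-p-group cyclic-p-group⇒power-complete
  , mk⇔ (power-complete⇒cyclic-p-group ∘ Super-Conjugate-complete⇒complete power⇒commuting)
        (complete⇒Super-complete Conjugate-refl ∘ cyclic-p-group⇒power-complete)
  , mk⇔ Super-SameOrder-power-complete⇒p-group p-group⇒Super-SameOrder-power-complete )
  , ( mk⇔ enhanced-complete⇒cyclic cyclic⇒enhanced-complete
    , mk⇔ (enhanced-complete⇒cyclic ∘ Super-Conjugate-complete⇒complete enhanced⇒commuting)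
          (complete⇒Super-complete Conjugate-refl ∘ cyclic⇒enhanced-complete)
    , mk⇔ (Super-SameOrder-commuting-complete⇒element-of-exponent-order exponent ∘ Super-complete-mono enhanced⇒commuting)
          (element-of-exponent-order⇒Super-SameOrder-enhanced-complete exponent) )
  , ( mk⇔ commuting-complete⇒abelian abelian⇒commuting-complete
    , mk⇔ Super-Conjugate-commuting-complete⇒abelian (complete⇒Super-complete Conjugate-refl ∘ abelian⇒commuting-complete)
    , mk⇔ (Super-SameOrder-commuting-complete⇒element-of-exponent-order exponent)
          (Super-complete-mono enhanced⇒commuting ∘ element-of-exponent-order⇒Super-SameOrder-enhanced-complete exponent) )
  where open CompleteGraphs G
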